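{- Let $(\alpha_n)_{n\in\mathbb{Z}}$ be a sequence with $\alpha_n=\alpha_{ -n}$, let $P_X(q)$ be a series in $q$, and define $N_X(m,n)$ by \[ R_X(z,q):=P_X(q)\left(1+\sum_{n=1}^\infty\frac{\alpha_nq^n(1-z)(1-z^{ -1})}{(1-zq^n)(1-z^{ -1}q^n)}\right)=\sum_{n=0}^\infty\sum_{m=-\infty}^\infty N_X(m,n)z^mq^n. \] Let $\eta^X_k(n)=\sum_{m=-\infty}^\infty\binom{m+\lfloor\frac{k-1}{2}\rfloor}{k}N_X(m,n)$. Then $\eta^X_{2k+1}(n)=0$ for all nonnegative integers $k$ and all $n$, and for every positive integer $k$, \[ \sum_{n=1}^\infty\eta^X_{2k}(n)q^n=-P_X(q)\sum_{n=1}^\infty\frac{\alpha_nq^{nk}}{(1-q^n)^{2k}}. \]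
   Context: Identities are of formal power series in $q$. -}

module Defs where

open import Data.Nat as ℕ using (ℕ; zero; suc; _≡ᵇ_; _∸_)
open import Data.Nat.DivMod using (_/_; _%_)
open import Data.Integer as ℤ using (ℤ; +_; -[1+_])
open import Data.Rational as ℚ using (ℚ; 0ℚ; 1ℚ)
open import Data.List using (List; []; _∷_; replicate; length; map; _++_)
open import Data.Bool using (if_then_else_)

sumℚ : (ℕ → ℚ) → ℕ → ℚ
sumℚ f zero    = 0ℚ
sumℚ f (suc n) = sumℚ f n ℚ.+ f n

ℤ→ℚ : ℤ → ℚ
ℤ→ℚ z = z ℚ./ 1

binomℚ : ℚ → ℕ → ℚ
binomℚ x zero    = 1ℚ
binomℚ x (suc k) = binomℚ x k ℚ.* ((x ℚ.- ℤ→ℚ (+ k)) ℚ.* (+ 1 ℚ./ suc k))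

-- Polynomials in z (coefficient lists, lowest degree first)

Poly : Set
Poly = List ℚ

addP : Poly → Poly → Poly
addP []      r       = r
addP (a ∷ p) []      = a ∷ p
addP (a ∷ p) (b ∷ r) = (a ℚ.+ b) ∷ addP p r

scaleP : ℚ → Poly → Poly
scaleP c = map (c ℚ.*_)

mulP : Poly → Poly → Poly
mulP []      r = []
mulP (a ∷ p) r = addP (scaleP a r) (0ℚ ∷ mulP p r)

shiftP : ℕ → Poly → Poly
shiftP k p = replicate k 0ℚ ++ p

coeffP : Poly → ℕ → ℚ
coeffP []      _       = 0ℚ
coeffP (a ∷ p) zero    = a
coeffP (a ∷ p) (suc i) = coeffP p i

-- Laurent polynomials in z:  laurent s p  represents  z^(-s) * p(z)

record Laurent : Set where
  constructor laurent
  field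
    lshift : ℕ
    lpoly  : Poly
open Laurent public

addL : Laurent → Laurent → Laurent
addL (laurent k p) (laurent l r) = laurent (k ℕ.+ l) (addP (shiftP l p) (shiftP k r))

mulL : Laurent → Laurent → Laurent
mulL (laurent k p) (laurent l r) = laurent (k ℕ.+ l) (mulP p r)

scaleL : ℚ → Laurent → Laurent
scaleL c (laurent k p) = laurent k (scaleP c p)

constL : ℚ → Laurent
constL c = laurent 0 (c ∷ [])

zeroL : Laurent
zeroL = laurent 0 []

oneL : Laurent
oneL = constL 1ℚ

negL : Laurent → Laurent
negL = scaleL (ℚ.- 1ℚ)

zL : Laurent
zL = laurent 0 (0ℚ ∷ 1ℚ ∷ [])

zinvL : Laurent
zinvL = laurent 1 (1ℚ ∷ [])

powL : Laurent → ℕ → Laurent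
powL x zero    = oneL
powL x (suc a) = mulL x (powL x a)

coeffAux : Poly → ℤ → ℚ
coeffAux p (+ i)    = coeffP p i
coeffAux p -[1+ _ ] = 0ℚ

coeffL : Laurent → ℤ → ℚ
coeffL (laurent k p) m = coeffAux p (m ℤ.+ + k)

sumL : (ℕ → Laurent) → ℕ → Laurent
sumL f zero    = zeroL
sumL f (suc n) = addL (sumL f n) (f n)

-- Formal power series in q with Laurent-polynomial (in z) coefficients

LSeries : Set
LSeries = ℕ → Laurent

addLS : LSeries → LSeries → LSeries
addLS f g N = addL (f N) (g N)

mulLS : LSeries → LSeries → LSeries
mulLS f g N = sumL (λ j → mulL (f j) (g (N ∸ j))) (suc N)

monoLS : ℕ → Laurent → LSeries
monoLS n x N = if N ≡ᵇ n then x else zeroL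

oneLS : LSeries
oneLS = monoLS 0 oneL

-- the series 1/(1 - x q^(suc j)) = Σ_a x^a q^(a (suc j))
geomLS : Laurent → ℕ → LSeries
geomLS x j N = if (N % suc j) ≡ᵇ 0 then powL x (N / suc j) else zeroL

liftLS : (ℕ → ℚ) → LSeries
liftLS P N = constL (P N)

-- T_n(z,q) = q^n (1-z)(1-z^{-1}) / ((1-zq^n)(1-z^{-1}q^n)),  n = suc j
termT : ℕ → LSeries
termT j = mulLS (monoLS (suc j) (mulL (addL oneL (negL zL)) (addL oneL (negL zinvL))))
                (mulLS (geomLS zL j) (geomLS zinvL j))

-- Σ_{n ≥ 1} α_n T_n ; only n ≤ N contribute to q^N since T_n = O(q^n)
sumαT : (ℤ → ℚ) → LSeries
sumαT α N = sumL (λ j → scaleL (α (+ suc j)) (termT j N)) N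

R-X : (ℕ → ℚ) → (ℤ → ℚ) → LSeries
R-X P α = mulLS (liftLS P) (addLS oneLS (sumαT α))

N-X : (ℕ → ℚ) → (ℤ → ℚ) → ℤ → ℕ → ℚ
N-X P α m n = coeffL (R-X P α n) m

-- The sum ranges over the (finite) window m = i - s, i < length p, where
-- R-X P α n = laurent s p; N_X(m,n) = 0 outside this window.
-- ⌊(k-1)/2⌋ is written (k ∸ 1) / 2 (exact for k ≥ 1; for k = 0 the binomial is 1 anyway).
η-X : (ℕ → ℚ) → (ℤ → ℚ) → ℕ → ℕ → ℚ
η-X P α k n =
  sumℚ (λ i → let m = (+ i) ℤ.- (+ lshift (R-X P α n)) in
              binomℚ (ℤ→ℚ (m ℤ.+ + ((k ∸ 1) / 2))) k ℚ.* N-X P α m n)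
       (length (lpoly (R-X P α n)))

Series : Set
Series = ℕ → ℚ

mulS : Series → Series → Series
mulS f g N = sumℚ (λ j → f j ℚ.* g (N ∸ j)) (suc N)

monoS : ℕ → ℚ → Series
monoS n c N = if N ≡ᵇ n then c else 0ℚ

oneS : Series
oneS = monoS 0 1ℚ

powS : Series → ℕ → Series
powS f zero    = oneS
powS f (suc a) = mulS f (powS f a)

-- 1/(1 - q^(suc j))
geomS : ℕ → Series
geomS j N = if (N % suc j) ≡ᵇ 0 then 1ℚ else 0ℚ

-- Σ_{n ≥ 1} α_n q^{nk} / (1 - q^n)^{2k}  (for k ≥ 1 only n ≤ N contribute to q^N)
sumRHS : (ℤ → ℚ) → ℕ → Series
sumRHS α k N =
  sumℚ (λ j → α (+ suc j) ℚ.* mulS (monoS (suc j ℕ.* k) 1ℚ) (powS (geomS j) (2 ℕ.* k)) N) N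

-- η_k(n) = Σ_m w(m) N_X(m,n) is a linear functional of R_X, namely the weighted coefficient sum
-- with weight w(m) = binom(m + ⌊(k-1)/2⌋, k).  Since T_n is T_1 with q replaced by q^n, it suffices
-- to weigh T_1 = q(1-z)(1-z⁻¹) / ((1-zq)(1-z⁻¹q)).  At q^(c+1) the factor (1-z)(1-z⁻¹) turns w into
-- its negated second difference, and the denominator sums that over d = -c, 2-c, …, c.  In both
-- cases below w(0) = 0, which removes the constant term 1 of R_X.
-- For k = 2j+1 the weight is odd in m, so everything cancels.  For k = 2j+2 the negated second
-- difference is -binom(d + j - 1, 2j), whose sum over d is -binom(c + j + 1, 2j + 1) by Pascal's
-- rule and the reflection binom(y, 2j) = binom(2j - 1 - y, 2j); this is minus the coefficient of
-- q^(c+1) in q^(j+1) / (1-q)^(2j+2).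

module Submission where

open import Defs
open import Data.Nat as ℕ using (ℕ; zero; suc; _≤_; _<_; _≡ᵇ_; _∸_; _+_; _*_; s≤s; z≤n)
import Data.Nat.Properties as ℕP
open import Data.Nat.DivMod
open import Data.Nat.Divisibility using (divides)
open import Data.Nat.Coprimality using (1-coprimeTo) renaming (sym to coprime-sym)
open import Data.Integer as ℤ using (ℤ; -_; +_; -[1+_])
import Data.Integer.Properties as ℤP
import Data.Integer.Tactic.RingSolver as ℤRing
import Data.Nat.Tactic.RingSolver as ℕRing
open import Data.Rational as ℚ using (ℚ; 0ℚ; 1ℚ; ½; mkℚ)
import Data.Rational.Properties as ℚP
open import Data.Rational.Solver
open import Data.List using ([]; _∷_; length)
open import Data.Bool using (true; false; if_then_else_)
open import Data.Bool.Properties using (if-float; if-eta; if-cong-then)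
open import Data.Product using (_×_; _,_)
open import Data.Sum using (inj₁; inj₂)
open import Data.Empty using (⊥-elim)
open import Function using (_∘_)
open import Level using (0ℓ)
open import Algebra.Bundles using (Monoid)
open import Algebra.Definitions using (LeftZero; RightZero)
open import Relation.Nullary using (yes; no)
open import Relation.Binary.PropositionalEquality
  using (_≡_; _≢_; refl; sym; trans; cong; cong₂; subst; subst₂; module ≡-Reasoning)

open +-*-Solver

ℤ→ℚ≡mkℚ : ∀ z → ℤ→ℚ z ≡ mkℚ z 0 (coprime-sym (1-coprimeTo ℤ.∣ z ∣))
ℤ→ℚ≡mkℚ z = ℚP.↥p/↧p≡p (mkℚ z 0 (coprime-sym (1-coprimeTo ℤ.∣ z ∣)))

ℤ→ℚ-+ : ∀ a b → ℤ→ℚ (a ℤ.+ b) ≡ ℤ→ℚ a ℚ.+ ℤ→ℚ b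
ℤ→ℚ-+ a b rewrite ℤ→ℚ≡mkℚ a | ℤ→ℚ≡mkℚ b =
  sym (cong (ℚ._/ 1) (cong₂ ℤ._+_ (ℤP.*-identityʳ a) (ℤP.*-identityʳ b)))

ℤ→ℚ-neg : ∀ a → ℤ→ℚ (- a) ≡ ℚ.- ℤ→ℚ a
ℤ→ℚ-neg a = begin
  ℤ→ℚ (- a)                                 ≡⟨ solve 2 (λ x y → y := (:- x) :+ (x :+ y)) refl (ℤ→ℚ a) (ℤ→ℚ (- a)) ⟩
  ℚ.- ℤ→ℚ a ℚ.+ (ℤ→ℚ a ℚ.+ ℤ→ℚ (- a))       ≡⟨ cong (ℚ.- ℤ→ℚ a ℚ.+_) (sym (ℤ→ℚ-+ a (- a))) ⟩
  ℚ.- ℤ→ℚ a ℚ.+ ℤ→ℚ (a ℤ.+ - a)             ≡⟨ cong (λ z → ℚ.- ℤ→ℚ a ℚ.+ ℤ→ℚ z) (ℤP.+-inverseʳ a) ⟩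
  ℚ.- ℤ→ℚ a ℚ.+ 0ℚ                          ≡⟨ ℚP.+-identityʳ _ ⟩
  ℚ.- ℤ→ℚ a                                 ∎
  where open ≡-Reasoning

ℕ→ℚ : ℕ → ℚ
ℕ→ℚ n = ℤ→ℚ (+ n)

ℕ→ℚ-+ : ∀ m n → ℕ→ℚ (m + n) ≡ ℕ→ℚ m ℚ.+ ℕ→ℚ n
ℕ→ℚ-+ m n = trans (cong ℤ→ℚ (ℤP.pos-+ m n)) (ℤ→ℚ-+ (+ m) (+ n))

ℕ→ℚ-suc : ∀ n → ℕ→ℚ (suc n) ≡ ℕ→ℚ n ℚ.+ 1ℚ
ℕ→ℚ-suc n = trans (cong ℕ→ℚ (ℕP.+-comm 1 n)) (ℕ→ℚ-+ n 1)

ℕ→ℚ-1+c+k : ∀ c k → ℕ→ℚ (suc (c + k)) ≡ ℕ→ℚ c ℚ.+ ℕ→ℚ k ℚ.+ 1ℚ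
ℕ→ℚ-1+c+k c k = trans (ℕ→ℚ-suc (c + k)) (cong (ℚ._+ 1ℚ) (ℕ→ℚ-+ c k))

[1+n]*1/[1+n]≡1 : ∀ n → (ℕ→ℚ n ℚ.+ 1ℚ) ℚ.* (+ 1 ℚ./ suc n) ≡ 1ℚ
[1+n]*1/[1+n]≡1 n
  rewrite sym (ℕ→ℚ-suc n)
        | ℚP.↥p/↧p≡p (mkℚ (+ 1) n (1-coprimeTo (suc n)))
        | ℤ→ℚ≡mkℚ (+ suc n)
  = ℚP.*-inverseʳ (mkℚ (+ suc n) 0 (coprime-sym (1-coprimeTo (suc n))))

x≡-x⇒x≡0 : ∀ x → x ≡ ℚ.- x → x ≡ 0ℚ
x≡-x⇒x≡0 x x≡-x = begin
  x                ≡⟨ solve 1 (λ x → x := con ½ :* (x :+ x)) refl x ⟩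
  ½ ℚ.* (x ℚ.+ x)  ≡⟨ cong (λ y → ½ ℚ.* (x ℚ.+ y)) x≡-x ⟩
  ½ ℚ.* (x ℚ.- x)  ≡⟨ cong (½ ℚ.*_) (ℚP.+-inverseʳ x) ⟩
  0ℚ               ∎
  where open ≡-Reasoning

-- Generalized binomial coefficients

falling : ℚ → ℕ → ℚ
falling x zero    = 1ℚ
falling x (suc r) = falling x r ℚ.* (x ℚ.- ℕ→ℚ r)

invFactorial : ℕ → ℚ
invFactorial zero    = 1ℚ
invFactorial (suc r) = invFactorial r ℚ.* (+ 1 ℚ./ suc r)

binom≡falling*invFactorial : ∀ x r → binomℚ x r ≡ falling x r ℚ.* invFactorial r
binom≡falling*invFactorial x zero = refl
binom≡falling*invFactorial x (suc r) rewrite binom≡falling*invFactorial x r =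
  solve 5 (λ f c x i r → (f :* c) :* ((x :- r) :* i) := (f :* (x :- r)) :* (c :* i)) refl
    (falling x r) (invFactorial r) x (+ 1 ℚ./ suc r) (ℕ→ℚ r)

binom-cong : ∀ {x y} r → x ≡ y → binomℚ x r ≡ binomℚ y r
binom-cong r = cong (λ x → binomℚ x r)

falling-pascal : ∀ x r →
  falling (x ℚ.+ 1ℚ) (suc r) ≡ falling x (suc r) ℚ.+ (ℕ→ℚ r ℚ.+ 1ℚ) ℚ.* falling x r
falling-pascal x zero =
  solve 1 (λ x → con 1ℚ :* (x :+ con 1ℚ :- con 0ℚ) := con 1ℚ :* (x :- con 0ℚ) :+ (con 0ℚ :+ con 1ℚ) :* con 1ℚ) refl x
falling-pascal x (suc r) rewrite falling-pascal x r | ℕ→ℚ-suc r =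
  solve 3 (λ f x r → (f :* (x :- r) :+ (r :+ con 1ℚ) :* f) :* (x :+ con 1ℚ :- (r :+ con 1ℚ))
                   := f :* (x :- r) :* (x :- (r :+ con 1ℚ)) :+ (r :+ con 1ℚ :+ con 1ℚ) :* (f :* (x :- r))) refl
    (falling x r) x (ℕ→ℚ r)

binom-pascal : ∀ x r → binomℚ (x ℚ.+ 1ℚ) (suc r) ≡ binomℚ x (suc r) ℚ.+ binomℚ x r
binom-pascal x r
  rewrite binom≡falling*invFactorial (x ℚ.+ 1ℚ) (suc r) | binom≡falling*invFactorial x (suc r)
        | binom≡falling*invFactorial x r | falling-pascal x r = begin
  (g ℚ.+ (ℕ→ℚ r ℚ.+ 1ℚ) ℚ.* f) ℚ.* (c ℚ.* i)
    ≡⟨ solve 5 (λ g f r c i → (g :+ (r :+ con 1ℚ) :* f) :* (c :* i)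
                           := g :* (c :* i) :+ f :* c :* ((r :+ con 1ℚ) :* i)) refl g f (ℕ→ℚ r) c i ⟩
  g ℚ.* (c ℚ.* i) ℚ.+ f ℚ.* c ℚ.* ((ℕ→ℚ r ℚ.+ 1ℚ) ℚ.* i)
    ≡⟨ cong (λ t → g ℚ.* (c ℚ.* i) ℚ.+ f ℚ.* c ℚ.* t) ([1+n]*1/[1+n]≡1 r) ⟩
  g ℚ.* (c ℚ.* i) ℚ.+ f ℚ.* c ℚ.* 1ℚ
    ≡⟨ cong (g ℚ.* (c ℚ.* i) ℚ.+_) (ℚP.*-identityʳ _) ⟩
  g ℚ.* (c ℚ.* i) ℚ.+ f ℚ.* c ∎
  where
  open ≡-Reasoning
  g = falling x (suc r)
  f = falling x r
  c = invFactorial r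
  i = + 1 ℚ./ suc r

falling-suc : ∀ y r → falling y (suc r) ≡ y ℚ.* falling (y ℚ.- 1ℚ) r
falling-suc y zero = solve 1 (λ y → con 1ℚ :* (y :- con 0ℚ) := y :* con 1ℚ) refl y
falling-suc y (suc r) rewrite falling-suc y r | ℕ→ℚ-suc r =
  solve 3 (λ y f r → y :* f :* (y :- (r :+ con 1ℚ)) := y :* (f :* (y :- con 1ℚ :- r))) refl
    y (falling (y ℚ.- 1ℚ) r) (ℕ→ℚ r)

sign : ℕ → ℚ
sign zero    = 1ℚ
sign (suc r) = ℚ.- sign r

sign-even : ∀ k → sign (k + k) ≡ 1ℚ
sign-even zero    = refl
sign-even (suc k) rewrite ℕP.+-suc k k =
  trans (solve 1 (λ s → :- (:- s) := s) refl (sign (k + k))) (sign-even k)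

falling-neg : ∀ x r → falling (ℚ.- x) r ≡ sign r ℚ.* falling (x ℚ.+ ℕ→ℚ r ℚ.- 1ℚ) r
falling-neg x zero    = refl
falling-neg x (suc r) rewrite falling-neg x r = begin
  sign r ℚ.* f ℚ.* (ℚ.- x ℚ.- ℕ→ℚ r)
    ≡⟨ solve 4 (λ s f x r → s :* f :* (:- x :- r) := (:- s) :* ((x :+ r) :* f)) refl (sign r) f x (ℕ→ℚ r) ⟩
  ℚ.- sign r ℚ.* ((x ℚ.+ ℕ→ℚ r) ℚ.* f)
    ≡⟨ cong (ℚ.- sign r ℚ.*_) (sym (falling-suc (x ℚ.+ ℕ→ℚ r) r)) ⟩
  ℚ.- sign r ℚ.* falling (x ℚ.+ ℕ→ℚ r) (suc r)
    ≡⟨ cong (λ t → ℚ.- sign r ℚ.* falling t (suc r)) x+r≡x+[1+r]-1 ⟩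
  ℚ.- sign r ℚ.* falling (x ℚ.+ ℕ→ℚ (suc r) ℚ.- 1ℚ) (suc r) ∎
  where
  open ≡-Reasoning
  f = falling (x ℚ.+ ℕ→ℚ r ℚ.- 1ℚ) r
  x+r≡x+[1+r]-1 : x ℚ.+ ℕ→ℚ r ≡ x ℚ.+ ℕ→ℚ (suc r) ℚ.- 1ℚ
  x+r≡x+[1+r]-1 rewrite ℕ→ℚ-suc r =
    solve 2 (λ x r → x :+ r := x :+ (r :+ con 1ℚ) :- con 1ℚ) refl x (ℕ→ℚ r)

binom-reflect : ∀ r y c → y ℚ.+ c ≡ ℕ→ℚ r ℚ.- 1ℚ → binomℚ y r ≡ sign r ℚ.* binomℚ c r
binom-reflect r y c y+c≡r-1
  rewrite binom≡falling*invFactorial y r | binom≡falling*invFactorial c r = begin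
  falling y r ℚ.* invFactorial r
    ≡⟨ cong (λ t → falling t r ℚ.* invFactorial r) y≡-x ⟩
  falling (ℚ.- x) r ℚ.* invFactorial r
    ≡⟨ cong (ℚ._* invFactorial r) (falling-neg x r) ⟩
  sign r ℚ.* falling (x ℚ.+ ℕ→ℚ r ℚ.- 1ℚ) r ℚ.* invFactorial r
    ≡⟨ cong (λ t → sign r ℚ.* falling t r ℚ.* invFactorial r)
         (solve 2 (λ c r → c :- r :+ con 1ℚ :+ r :- con 1ℚ := c) refl c (ℕ→ℚ r)) ⟩
  sign r ℚ.* falling c r ℚ.* invFactorial r
    ≡⟨ ℚP.*-assoc (sign r) _ _ ⟩
  sign r ℚ.* (falling c r ℚ.* invFactorial r) ∎
  where
  open ≡-Reasoning
  x = c ℚ.- ℕ→ℚ r ℚ.+ 1ℚ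
  y≡-x : y ≡ ℚ.- x
  y≡-x = begin
    y                       ≡⟨ solve 2 (λ y c → y := (y :+ c) :- c) refl y c ⟩
    (y ℚ.+ c) ℚ.- c         ≡⟨ cong (ℚ._- c) y+c≡r-1 ⟩
    (ℕ→ℚ r ℚ.- 1ℚ) ℚ.- c    ≡⟨ solve 2 (λ c r → (r :- con 1ℚ) :- c := :- (c :- r :+ con 1ℚ)) refl c (ℕ→ℚ r) ⟩
    ℚ.- x                   ∎

falling-vanish : ∀ n r → n < r → falling (ℕ→ℚ n) r ≡ 0ℚ
falling-vanish n (suc r) n<1+r with ℕP.m≤n⇒m<n∨m≡n (ℕP.≤-pred n<1+r)
... | inj₁ n<r rewrite falling-vanish n r n<r = ℚP.*-zeroˡ (ℕ→ℚ n ℚ.- ℕ→ℚ r)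
... | inj₂ refl = trans (cong (falling (ℕ→ℚ n) n ℚ.*_) (ℚP.+-inverseʳ (ℕ→ℚ n))) (ℚP.*-zeroʳ (falling (ℕ→ℚ n) n))

binom-vanish : ∀ n r → n < r → binomℚ (ℕ→ℚ n) r ≡ 0ℚ
binom-vanish n r n<r rewrite binom≡falling*invFactorial (ℕ→ℚ n) r | falling-vanish n r n<r =
  ℚP.*-zeroˡ (invFactorial r)

binom-secondDiff : ∀ y r →
  (binomℚ y (suc (suc r)) ℚ.- binomℚ (y ℚ.- 1ℚ) (suc (suc r))) ℚ.-
  (binomℚ (y ℚ.+ 1ℚ) (suc (suc r)) ℚ.- binomℚ y (suc (suc r))) ≡ ℚ.- binomℚ (y ℚ.- 1ℚ) r
binom-secondDiff y r = begin
  (B y ℚ.- B y') ℚ.- (B (y ℚ.+ 1ℚ) ℚ.- B y)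
    ≡⟨ cong (λ t → (B y ℚ.- B y') ℚ.- (t ℚ.- B y)) (binom-pascal y (suc r)) ⟩
  (B y ℚ.- B y') ℚ.- ((B y ℚ.+ binomℚ y (suc r)) ℚ.- B y)
    ≡⟨ cong₂ (λ a b → (a ℚ.- B y') ℚ.- ((a ℚ.+ b) ℚ.- a)) (pascal-at-y (suc r)) (pascal-at-y r) ⟩
  ((B y' ℚ.+ p) ℚ.- B y') ℚ.- (((B y' ℚ.+ p) ℚ.+ (p ℚ.+ q)) ℚ.- (B y' ℚ.+ p))
    ≡⟨ solve 3 (λ a p q → ((a :+ p) :- a) :- ((a :+ p) :+ (p :+ q) :- (a :+ p)) := :- q) refl (B y') p q ⟩
  ℚ.- q ∎
  where
  open ≡-Reasoning
  y' = y ℚ.- 1ℚ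
  B = λ x → binomℚ x (suc (suc r))
  p = binomℚ y' (suc r)
  q = binomℚ y' r
  pascal-at-y : ∀ s → binomℚ y (suc s) ≡ binomℚ y' (suc s) ℚ.+ binomℚ y' s
  pascal-at-y s = trans (binom-cong (suc s) (solve 1 (λ y → y := y :- con 1ℚ :+ con 1ℚ) refl y))
                        (binom-pascal y' s)

sumℚ-cong : ∀ {f g : ℕ → ℚ} n → (∀ i → i < n → f i ≡ g i) → sumℚ f n ≡ sumℚ g n
sumℚ-cong zero    f≡g = refl
sumℚ-cong (suc n) f≡g = cong₂ ℚ._+_ (sumℚ-cong n (λ i i<n → f≡g i (ℕP.m<n⇒m<1+n i<n))) (f≡g n ℕP.≤-refl)

sumℚ-suc : ∀ (f : ℕ → ℚ) n → sumℚ f (suc n) ≡ f 0 ℚ.+ sumℚ (λ i → f (suc i)) n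
sumℚ-suc f zero    = ℚP.+-comm 0ℚ (f 0)
sumℚ-suc f (suc n) rewrite sumℚ-suc f n = ℚP.+-assoc (f 0) _ _

sumℚ-+ : ∀ (f g : ℕ → ℚ) n → sumℚ (λ i → f i ℚ.+ g i) n ≡ sumℚ f n ℚ.+ sumℚ g n
sumℚ-+ f g zero    = refl
sumℚ-+ f g (suc n) rewrite sumℚ-+ f g n =
  solve 4 (λ a b c d → (a :+ b) :+ (c :+ d) := (a :+ c) :+ (b :+ d)) refl (sumℚ f n) (sumℚ g n) (f n) (g n)

sumℚ-neg : ∀ (f : ℕ → ℚ) n → sumℚ (λ i → ℚ.- f i) n ≡ ℚ.- sumℚ f n
sumℚ-neg f zero    = refl
sumℚ-neg f (suc n) rewrite sumℚ-neg f n = sym (ℚP.neg-distrib-+ (sumℚ f n) (f n))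

sumℚ-zero : ∀ n → sumℚ (λ _ → 0ℚ) n ≡ 0ℚ
sumℚ-zero zero    = refl
sumℚ-zero (suc n) rewrite sumℚ-zero n = refl

sumℚ-vanish : ∀ (f : ℕ → ℚ) n → (∀ i → i < n → f i ≡ 0ℚ) → sumℚ f n ≡ 0ℚ
sumℚ-vanish f n f≡0 = trans (sumℚ-cong n f≡0) (sumℚ-zero n)

-- Weighted coefficient sums

[a+b]-[c+a]≡b-c : ∀ a b c → (a ℤ.+ b) ℤ.- (c ℤ.+ a) ≡ b ℤ.- c
[a+b]-[c+a]≡b-c = ℤRing.solve-∀

[a+b]-[a+c]≡b-c : ∀ a b c → (a ℤ.+ b) ℤ.- (a ℤ.+ c) ≡ b ℤ.- c
[a+b]-[a+c]≡b-c = ℤRing.solve-∀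

[a+b]-[c+d]≡[a-c]+[b-d] : ∀ a b c d → (a ℤ.+ b) ℤ.- (c ℤ.+ d) ≡ (a ℤ.- c) ℤ.+ (b ℤ.- d)
[a+b]-[c+d]≡[a-c]+[b-d] = ℤRing.solve-∀

weightP : (ℕ → ℚ) → Poly → ℚ
weightP f []      = 0ℚ
weightP f (a ∷ p) = f 0 ℚ.* a ℚ.+ weightP (λ i → f (suc i)) p

-- weight w L = Σₘ w m · [zᵐ] L
weight : (ℤ → ℚ) → Laurent → ℚ
weight w (laurent s p) = weightP (λ i → w (+ i ℤ.- + s)) p

weightP-cong : ∀ {f g : ℕ → ℚ} p → (∀ i → f i ≡ g i) → weightP f p ≡ weightP g p
weightP-cong []      f≡g = refl
weightP-cong (a ∷ p) f≡g = cong₂ ℚ._+_ (cong (ℚ._* a) (f≡g 0)) (weightP-cong p (λ i → f≡g (suc i)))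

weightP-zero : ∀ p → weightP (λ _ → 0ℚ) p ≡ 0ℚ
weightP-zero []      = refl
weightP-zero (a ∷ p) rewrite weightP-zero p = trans (ℚP.+-identityʳ _) (ℚP.*-zeroˡ a)

weightP-addP : ∀ f p r → weightP f (addP p r) ≡ weightP f p ℚ.+ weightP f r
weightP-addP f []      r       = sym (ℚP.+-identityˡ _)
weightP-addP f (a ∷ p) []      = sym (ℚP.+-identityʳ _)
weightP-addP f (a ∷ p) (b ∷ r) rewrite weightP-addP (λ i → f (suc i)) p r =
  solve 5 (λ x a b u v → x :* (a :+ b) :+ (u :+ v) := (x :* a :+ u) :+ (x :* b :+ v)) refl
    (f 0) a b (weightP (λ i → f (suc i)) p) (weightP (λ i → f (suc i)) r)

weightP-scaleP : ∀ f c p → weightP f (scaleP c p) ≡ c ℚ.* weightP f p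
weightP-scaleP f c []      = sym (ℚP.*-zeroʳ c)
weightP-scaleP f c (a ∷ p) rewrite weightP-scaleP (λ i → f (suc i)) c p =
  solve 4 (λ x c a u → x :* (c :* a) :+ c :* u := c :* (x :* a :+ u)) refl (f 0) c a (weightP (λ i → f (suc i)) p)

weightP-shiftP : ∀ f k p → weightP f (shiftP k p) ≡ weightP (λ i → f (k + i)) p
weightP-shiftP f zero    p = refl
weightP-shiftP f (suc k) p rewrite weightP-shiftP (λ i → f (suc i)) k p =
  trans (cong (ℚ._+ rest) (ℚP.*-zeroʳ (f 0))) (ℚP.+-identityˡ rest)
  where rest = weightP (λ i → f (suc (k + i))) p

weightP-mulP : ∀ f p r → weightP f (mulP p r) ≡ weightP (λ i → weightP (λ j → f (i + j)) r) p
weightP-mulP f []      r = refl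
weightP-mulP f (a ∷ p) r
  rewrite weightP-addP f (scaleP a r) (0ℚ ∷ mulP p r) | weightP-scaleP f a r
        | weightP-mulP (λ i → f (suc i)) p r =
  solve 4 (λ a u x v → a :* u :+ (x :* con 0ℚ :+ v) := u :* a :+ v) refl
    a (weightP f r) (f 0) (weightP (λ i → weightP (λ j → f (suc (i + j))) r) p)

weightP≡sumℚ : ∀ f p → sumℚ (λ i → f i ℚ.* coeffP p i) (length p) ≡ weightP f p
weightP≡sumℚ f []      = refl
weightP≡sumℚ f (a ∷ p) =
  trans (sumℚ-suc _ (length p)) (cong (f 0 ℚ.* a ℚ.+_) (weightP≡sumℚ (λ i → f (suc i)) p))

weight-cong : ∀ {w v : ℤ → ℚ} A → (∀ m → w m ≡ v m) → weight w A ≡ weight v A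
weight-cong (laurent s p) w≡v = weightP-cong p (λ i → w≡v _)

weight-addL : ∀ w A B → weight w (addL A B) ≡ weight w A ℚ.+ weight w B
weight-addL w (laurent k p) (laurent l r)
  rewrite weightP-addP (λ i → w (+ i ℤ.- + (k + l))) (shiftP l p) (shiftP k r)
        | weightP-shiftP (λ i → w (+ i ℤ.- + (k + l))) l p
        | weightP-shiftP (λ i → w (+ i ℤ.- + (k + l))) k r =
  cong₂ ℚ._+_ (weightP-cong p (λ i → cong w (+[l+i]-+[k+l] i)))
              (weightP-cong r (λ i → cong w (+[k+i]-+[k+l] i)))
  where
  +[l+i]-+[k+l] : ∀ i → + (l + i) ℤ.- + (k + l) ≡ + i ℤ.- + k
  +[l+i]-+[k+l] i = trans (cong₂ ℤ._-_ (ℤP.pos-+ l i) (ℤP.pos-+ k l)) ([a+b]-[c+a]≡b-c (+ l) (+ i) (+ k))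
  +[k+i]-+[k+l] : ∀ i → + (k + i) ℤ.- + (k + l) ≡ + i ℤ.- + l
  +[k+i]-+[k+l] i = trans (cong₂ ℤ._-_ (ℤP.pos-+ k i) (ℤP.pos-+ k l)) ([a+b]-[a+c]≡b-c (+ k) (+ i) (+ l))

weight-mulL : ∀ w A B → weight w (mulL A B) ≡ weight (λ d → weight (λ m → w (d ℤ.+ m)) B) A
weight-mulL w (laurent k p) (laurent l r) rewrite weightP-mulP (λ i → w (+ i ℤ.- + (k + l))) p r =
  weightP-cong p (λ i → weightP-cong r (λ j → cong w (+[i+j]-+[k+l] i j)))
  where
  +[i+j]-+[k+l] : ∀ i j → + (i + j) ℤ.- + (k + l) ≡ (+ i ℤ.- + k) ℤ.+ (+ j ℤ.- + l)
  +[i+j]-+[k+l] i j = trans (cong₂ ℤ._-_ (ℤP.pos-+ i j) (ℤP.pos-+ k l)) ([a+b]-[c+d]≡[a-c]+[b-d] (+ i) (+ j) (+ k) (+ l))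

weight-mulL-zeroʳ : ∀ w A → weight w (mulL A zeroL) ≡ 0ℚ
weight-mulL-zeroʳ w (laurent k p) = trans (weight-mulL w (laurent k p) zeroL) (weightP-zero p)

weight-scaleL : ∀ w c A → weight w (scaleL c A) ≡ c ℚ.* weight w A
weight-scaleL w c (laurent k p) = weightP-scaleP _ c p

weight-negL : ∀ w A → weight w (negL A) ≡ ℚ.- weight w A
weight-negL w A = trans (weight-scaleL w (ℚ.- 1ℚ) A) (solve 1 (λ x → (:- con 1ℚ) :* x := :- x) refl (weight w A))

weight-constL : ∀ w c → weight w (constL c) ≡ w (+ 0) ℚ.* c
weight-constL w c = ℚP.+-identityʳ _

weight-oneL : ∀ w → weight w oneL ≡ w (+ 0)
weight-oneL w = trans (weight-constL w 1ℚ) (ℚP.*-identityʳ _)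

weight-zL : ∀ w → weight w zL ≡ w (+ 1)
weight-zL w = solve 2 (λ a b → a :* con 0ℚ :+ (b :* con 1ℚ :+ con 0ℚ) := b) refl (w (+ 0)) (w (+ 1))

weight-zinvL : ∀ w → weight w zinvL ≡ w -[1+ 0 ]
weight-zinvL w = solve 1 (λ a → a :* con 1ℚ :+ con 0ℚ := a) refl (w -[1+ 0 ])

weight-powL-zL : ∀ w a → weight w (powL zL a) ≡ w (+ a)
weight-powL-zL w zero    = weight-oneL w
weight-powL-zL w (suc a) =
  trans (weight-mulL w zL (powL zL a))
    (trans (weight-zL (λ d → weight (λ m → w (d ℤ.+ m)) (powL zL a)))
           (weight-powL-zL (λ m → w (+ 1 ℤ.+ m)) a))

weight-powL-zinvL : ∀ w a → weight w (powL zinvL a) ≡ w (- + a)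
weight-powL-zinvL w zero    = weight-oneL w
weight-powL-zinvL w (suc a) =
  trans (weight-mulL w zinvL (powL zinvL a))
    (trans (weight-zinvL (λ d → weight (λ m → w (d ℤ.+ m)) (powL zinvL a)))
      (trans (weight-powL-zinvL (λ m → w (-[1+ 0 ] ℤ.+ m)) a) (cong w (-1-+a≡-+[1+a] a))))
  where
  -1-+a≡-+[1+a] : ∀ a → -[1+ 0 ] ℤ.+ - + a ≡ - + suc a
  -1-+a≡-+[1+a] zero    = refl
  -1-+a≡-+[1+a] (suc a) = refl

weight-sumL : ∀ w f n → weight w (sumL f n) ≡ sumℚ (λ j → weight w (f j)) n
weight-sumL w f zero    = refl
weight-sumL w f (suc n) = trans (weight-addL w (sumL f n) (f n)) (cong (ℚ._+ weight w (f n)) (weight-sumL w f n))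

-- Dilation q ↦ q^(1+t) of power series

≡ᵇ-refl : ∀ m → (m ≡ᵇ m) ≡ true
≡ᵇ-refl zero    = refl
≡ᵇ-refl (suc m) = ≡ᵇ-refl m

≢⇒≡ᵇ≡false : ∀ m n → m ≢ n → (m ≡ᵇ n) ≡ false
≢⇒≡ᵇ≡false zero    zero    m≢n = ⊥-elim (m≢n refl)
≢⇒≡ᵇ≡false zero    (suc n) m≢n = refl
≢⇒≡ᵇ≡false (suc m) zero    m≢n = refl
≢⇒≡ᵇ≡false (suc m) (suc n) m≢n = ≢⇒≡ᵇ≡false m n (λ m≡n → m≢n (cong suc m≡n))

monomial-dilate : ∀ {A : Set} (x z : A) t a n N → n ≡ a * suc t →
  (if N ≡ᵇ n then x else z) ≡ (if N % suc t ≡ᵇ 0 then (if N / suc t ≡ᵇ a then x else z) else z)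
monomial-dilate x z t a n N n≡a*e with N % suc t ℕP.≟ 0
... | yes N%e≡0 = begin
  (if N ≡ᵇ n then x else z)         ≡⟨ cong (λ M → if M ≡ᵇ n then x else z) N≡c*e ⟩
  (if c * e ≡ᵇ n then x else z)     ≡⟨ cong (λ b → if b then x else z) c*e≡ᵇn≡c≡ᵇa ⟩
  (if c ≡ᵇ a then x else z)         ≡⟨ cong (λ m → if m ≡ᵇ 0 then (if c ≡ᵇ a then x else z) else z) (sym N%e≡0) ⟩
  (if N % e ≡ᵇ 0 then (if c ≡ᵇ a then x else z) else z) ∎
  where
  open ≡-Reasoning
  e = suc t
  c = N / e
  N≡c*e : N ≡ c * e
  N≡c*e = trans (m≡m%n+[m/n]*n N e) (cong (_+ c * e) N%e≡0)
  c*e≡ᵇn≡c≡ᵇa : (c * e ≡ᵇ n) ≡ (c ≡ᵇ a)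
  c*e≡ᵇn≡c≡ᵇa rewrite n≡a*e with c ℕP.≟ a
  ... | yes refl = trans (≡ᵇ-refl (c * e)) (sym (≡ᵇ-refl c))
  ... | no c≢a   = trans (≢⇒≡ᵇ≡false (c * e) (a * e) (λ eq → c≢a (ℕP.*-cancelʳ-≡ c a e eq)))
                         (sym (≢⇒≡ᵇ≡false c a c≢a))
... | no N%e≢0 rewrite ≢⇒≡ᵇ≡false N n (λ N≡n → N%e≢0 (trans (cong (_% suc t) (trans N≡n n≡a*e)) (m*n%n≡0 a (suc t))))
  with N % suc t
...   | zero  = ⊥-elim (N%e≢0 refl)
...   | suc _ = refl

between-multiples : ∀ t c i → i < t → (suc (c * suc t) + i) % suc t ≢ 0
between-multiples t c i i<t ≡0 = ℕP.1+n≢0 (begin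
  suc i                   ≡⟨ m<n⇒m%n≡m (s≤s i<t) ⟨
  suc i % e               ≡⟨ [m+kn]%n≡m%n (suc i) c e ⟨
  (suc i + c * e) % e     ≡⟨ cong (λ x → suc x % e) (ℕP.+-comm i (c * e)) ⟩
  (suc (c * e) + i) % e   ≡⟨ ≡0 ⟩
  0                       ∎)
  where
  open ≡-Reasoning
  e = suc t

module Dilation {o ℓ} (M : Monoid o ℓ)
  (_⊗_ : Monoid.Carrier M → Monoid.Carrier M → Monoid.Carrier M)
  (⊗-zeroˡ : LeftZero (Monoid._≈_ M) (Monoid.ε M) _⊗_)
  (⊗-zeroʳ : RightZero (Monoid._≈_ M) (Monoid.ε M) _⊗_) where

  open Monoid M using (Carrier; _≈_; setoid; ∙-cong; assoc; identityˡ; identityʳ; reflexive)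
                renaming (_∙_ to _⊕_; ε to 𝟘; refl to ≈-refl; trans to ≈-trans; sym to ≈-sym)
  open import Relation.Binary.Reasoning.Setoid setoid

  Σ< : (ℕ → Carrier) → ℕ → Carrier
  Σ< f zero    = 𝟘
  Σ< f (suc n) = Σ< f n ⊕ f n

  conv : (ℕ → Carrier) → (ℕ → Carrier) → ℕ → Carrier
  conv f g N = Σ< (λ j → f j ⊗ g (N ∸ j)) (suc N)

  dilate : ℕ → (ℕ → Carrier) → ℕ → Carrier
  dilate t f N = if N % suc t ≡ᵇ 0 then f (N / suc t) else 𝟘

  Σ<-cong : ∀ {f g} n → (∀ i → i < n → f i ≈ g i) → Σ< f n ≈ Σ< g n
  Σ<-cong zero    f≈g = ≈-refl
  Σ<-cong (suc n) f≈g = ∙-cong (Σ<-cong n (λ i i<n → f≈g i (ℕP.m<n⇒m<1+n i<n))) (f≈g n ℕP.≤-refl)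

  Σ<-vanish : ∀ f n → (∀ i → i < n → f i ≈ 𝟘) → Σ< f n ≈ 𝟘
  Σ<-vanish f n f≈0 = ≈-trans (Σ<-cong n f≈0) (zeros n)
    where
    zeros : ∀ n → Σ< (λ _ → 𝟘) n ≈ 𝟘
    zeros zero    = ≈-refl
    zeros (suc n) = ≈-trans (∙-cong (zeros n) ≈-refl) (identityˡ 𝟘)

  Σ<-+ : ∀ f m n → Σ< f (m + n) ≈ Σ< f m ⊕ Σ< (λ i → f (m + i)) n
  Σ<-+ f m zero    rewrite ℕP.+-identityʳ m = ≈-sym (identityʳ _)
  Σ<-+ f m (suc n) rewrite ℕP.+-suc m n = ≈-trans (∙-cong (Σ<-+ f m n) ≈-refl) (assoc _ _ _)

  dilate-* : ∀ t f a → dilate t f (a * suc t) ≡ f a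
  dilate-* t f a rewrite m*n%n≡0 a (suc t) ⦃ _ ⦄ | m*n/n≡m a (suc t) ⦃ _ ⦄ = refl

  dilate-∤ : ∀ t f N → N % suc t ≢ 0 → dilate t f N ≡ 𝟘
  dilate-∤ t f N N∤ with N % suc t in N%e
  ... | zero  = ⊥-elim (N∤ refl)
  ... | suc _ = refl

  Σ<-multiples : ∀ t h → (∀ j → j % suc t ≢ 0 → h j ≈ 𝟘) →
                 ∀ c → Σ< h (suc (c * suc t)) ≈ Σ< (λ a → h (a * suc t)) (suc c)
  Σ<-multiples t h h≈0 zero    = ≈-refl
  Σ<-multiples t h h≈0 (suc c) = begin
    Σ< h (suc (suc c * e))                               ≡⟨ cong (Σ< h) (cong suc (ℕP.+-comm e (c * e))) ⟩
    Σ< h (suc (c * e) + e)                               ≈⟨ Σ<-+ h (suc (c * e)) e ⟩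
    Σ< h (suc (c * e)) ⊕ Σ< (λ i → h (suc (c * e) + i)) e ≈⟨ ∙-cong (Σ<-multiples t h h≈0 c) last-block ⟩
    Σ< (λ a → h (a * e)) (suc c) ⊕ h (suc c * e)          ∎
    where
    e = suc t
    last-block : Σ< (λ i → h (suc (c * e) + i)) e ≈ h (suc c * e)
    last-block = begin
      Σ< (λ i → h (suc (c * e) + i)) t ⊕ h (suc (c * e) + t)
        ≈⟨ ∙-cong (Σ<-vanish _ t (λ i i<t → h≈0 _ (between-multiples t c i i<t))) ≈-refl ⟩
      𝟘 ⊕ h (suc (c * e) + t)  ≈⟨ identityˡ _ ⟩
      h (suc (c * e) + t)      ≡⟨ cong (λ x → h (suc x)) (ℕP.+-comm (c * e) t) ⟩
      h (suc c * e)            ∎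

  conv-dilate-∤ : ∀ t f g N → N % suc t ≢ 0 → conv (dilate t f) (dilate t g) N ≈ 𝟘
  conv-dilate-∤ t f g N N∤ = Σ<-vanish _ (suc N) term≈0
    where
    e = suc t
    term≈0 : ∀ j → j < suc N → (dilate t f j ⊗ dilate t g (N ∸ j)) ≈ 𝟘
    term≈0 j j≤N with j % e ℕP.≟ 0
    ... | no  j∤ = ≈-trans (∙-cong′ (dilate-∤ t f j j∤)) (⊗-zeroˡ _)
      where ∙-cong′ = λ eq → reflexive (cong (_⊗ dilate t g (N ∸ j)) eq)
    ... | yes j∣ = ≈-trans (reflexive (cong (dilate t f j ⊗_) (dilate-∤ t g (N ∸ j) N∸j∤))) (⊗-zeroʳ _)
      where
      j≡ : j ≡ (j / e) * e
      j≡ = trans (m≡m%n+[m/n]*n j e) (cong (_+ (j / e) * e) j∣)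
      N∸j∤ : (N ∸ j) % e ≢ 0
      N∸j∤ ≡0 = N∤ (trans (sym (m*n≤o⇒[o∸m*n]%n≡o%n (j / e) (subst (_≤ N) j≡ (ℕP.≤-pred j≤N))))
                          (trans (cong (λ x → (N ∸ x) % e) (sym j≡)) ≡0))

  conv-dilate-* : ∀ t f g c → conv (dilate t f) (dilate t g) (c * suc t) ≈ conv f g c
  conv-dilate-* t f g c = begin
    Σ< h (suc (c * e))               ≈⟨ Σ<-multiples t h h≈0 c ⟩
    Σ< (λ a → h (a * e)) (suc c)     ≈⟨ Σ<-cong (suc c) (λ a _ → reflexive (h-at-multiple a)) ⟩
    conv f g c                       ∎
    where
    e = suc t
    h : ℕ → Carrier
    h j = dilate t f j ⊗ dilate t g (c * e ∸ j)
    h≈0 : ∀ j → j % e ≢ 0 → h j ≈ 𝟘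
    h≈0 j j∤ = ≈-trans (reflexive (cong (_⊗ dilate t g (c * e ∸ j)) (dilate-∤ t f j j∤))) (⊗-zeroˡ _)
    h-at-multiple : ∀ a → h (a * e) ≡ (f a ⊗ g (c ∸ a))
    h-at-multiple a rewrite dilate-* t f a | sym (ℕP.*-distribʳ-∸ e c a) | dilate-* t g (c ∸ a) = refl

  conv-dilate : ∀ t f g N → conv (dilate t f) (dilate t g) N ≈ dilate t (conv f g) N
  conv-dilate t f g N with N % suc t ℕP.≟ 0
  ... | no  N∤ = ≈-trans (conv-dilate-∤ t f g N N∤) (reflexive (sym (dilate-∤ t (conv f g) N N∤)))
  ... | yes N∣ = subst (λ M → conv (dilate t f) (dilate t g) M ≈ dilate t (conv f g) M) (sym N≡c*e)
                   (≈-trans (conv-dilate-* t f g c) (reflexive (sym (dilate-* t (conv f g) c))))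
    where
    c = N / suc t
    N≡c*e : N ≡ c * suc t
    N≡c*e = trans (m≡m%n+[m/n]*n N (suc t)) (cong (_+ c * suc t) N∣)

module ℚDilation = Dilation ℚP.+-0-monoid ℚ._*_ ℚP.*-zeroˡ ℚP.*-zeroʳ
open ℚDilation using () renaming (dilate to dilateℚ)

Σ<≡sumℚ : ∀ f n → ℚDilation.Σ< f n ≡ sumℚ f n
Σ<≡sumℚ f zero    = refl
Σ<≡sumℚ f (suc n) = cong (ℚ._+ f n) (Σ<≡sumℚ f n)

dilateℚ-cong : ∀ t {f g : ℕ → ℚ} N → (∀ c → f c ≡ g c) → dilateℚ t f N ≡ dilateℚ t g N
dilateℚ-cong t N f≡g = if-cong-then (N % suc t ≡ᵇ 0) (f≡g _)

dilateℚ-zero : ∀ t N → dilateℚ t (λ _ → 0ℚ) N ≡ 0ℚ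
dilateℚ-zero t N = if-eta (N % suc t ≡ᵇ 0)

dilateℚ-neg : ∀ t f N → dilateℚ t (λ c → ℚ.- f c) N ≡ ℚ.- dilateℚ t f N
dilateℚ-neg t f N = sym (if-float ℚ.-_ (N % suc t ≡ᵇ 0))

mulS-cong : ∀ f {g g′ : Series} N → (∀ i → g i ≡ g′ i) → mulS f g N ≡ mulS f g′ N
mulS-cong f N g≡g′ = sumℚ-cong (suc N) (λ j _ → cong (f j ℚ.*_) (g≡g′ _))

mulS-dilate : ∀ t f g N → mulS (dilateℚ t f) (dilateℚ t g) N ≡ dilateℚ t (mulS f g) N
mulS-dilate t f g N =
  trans (sym (Σ<≡sumℚ _ (suc N)))
    (trans (ℚDilation.conv-dilate t f g N) (dilateℚ-cong t N (λ c → Σ<≡sumℚ (λ j → f j ℚ.* g (c ∸ j)) (suc c))))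

-- Laurent polynomials are compared through all weighted coefficient sums: this identifies the
-- many representations  laurent s p  of one Laurent polynomial.
record _≈L_ (A B : Laurent) : Set where
  constructor mk≈L
  field weight-≡ : ∀ w → weight w A ≡ weight w B
open _≈L_

≡⇒≈L : ∀ {A B} → A ≡ B → A ≈L B
≡⇒≈L refl = mk≈L (λ w → refl)

addL-cong : ∀ {A A′ B B′} → A ≈L A′ → B ≈L B′ → addL A B ≈L addL A′ B′
addL-cong {A} {A′} {B} {B′} A≈A′ B≈B′ = mk≈L λ w →
  trans (weight-addL w A B) (trans (cong₂ ℚ._+_ (weight-≡ A≈A′ w) (weight-≡ B≈B′ w)) (sym (weight-addL w A′ B′)))

mulL-cong : ∀ {A A′ B B′} → A ≈L A′ → B ≈L B′ → mulL A B ≈L mulL A′ B′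
mulL-cong {A} {A′} {B} {B′} A≈A′ B≈B′ = mk≈L λ w →
  trans (weight-mulL w A B)
    (trans (weight-cong A (λ d → weight-≡ B≈B′ (λ m → w (d ℤ.+ m))))
      (trans (weight-≡ A≈A′ (λ d → weight (λ m → w (d ℤ.+ m)) B′)) (sym (weight-mulL w A′ B′))))

laurent-+-monoid : Monoid 0ℓ 0ℓ
laurent-+-monoid = record
  { Carrier  = Laurent
  ; _≈_      = _≈L_
  ; _∙_      = addL
  ; ε        = zeroL
  ; isMonoid = record
    { isSemigroup = record
      { isMagma = record
        { isEquivalence = record
          { refl  = mk≈L (λ w → refl)
          ; sym   = λ A≈B → mk≈L (λ w → sym (weight-≡ A≈B w))
          ; trans = λ A≈B B≈C → mk≈L (λ w → trans (weight-≡ A≈B w) (weight-≡ B≈C w))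
          }
        ; ∙-cong = addL-cong
        }
      ; assoc = λ A B C → mk≈L λ w → begin
          weight w (addL (addL A B) C)                ≡⟨ weight-addL w (addL A B) C ⟩
          weight w (addL A B) ℚ.+ weight w C          ≡⟨ cong (ℚ._+ weight w C) (weight-addL w A B) ⟩
          weight w A ℚ.+ weight w B ℚ.+ weight w C    ≡⟨ ℚP.+-assoc (weight w A) (weight w B) (weight w C) ⟩
          weight w A ℚ.+ (weight w B ℚ.+ weight w C)  ≡⟨ cong (weight w A ℚ.+_) (weight-addL w B C) ⟨
          weight w A ℚ.+ weight w (addL B C)          ≡⟨ weight-addL w A (addL B C) ⟨
          weight w (addL A (addL B C))                ∎
      }
    ; identity = (λ A → mk≈L λ w → trans (weight-addL w zeroL A) (ℚP.+-identityˡ (weight w A)))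
               , (λ A → mk≈L λ w → trans (weight-addL w A zeroL) (ℚP.+-identityʳ (weight w A)))
    }
  }
  where open ≡-Reasoning

mulL-zeroˡ : LeftZero _≈L_ zeroL mulL
mulL-zeroˡ B = mk≈L (λ w → weight-mulL w zeroL B)

mulL-zeroʳ : RightZero _≈L_ zeroL mulL
mulL-zeroʳ A = mk≈L (λ w → weight-mulL-zeroʳ w A)

module LaurentDilation = Dilation laurent-+-monoid mulL mulL-zeroˡ mulL-zeroʳ
open LaurentDilation using () renaming (dilate to dilateL)

weight-dilateL : ∀ w t f N → weight w (dilateL t f N) ≡ dilateℚ t (λ c → weight w (f c)) N
weight-dilateL w t f N = if-float (weight w) (N % suc t ≡ᵇ 0)

Σ<≡sumL : ∀ f n → LaurentDilation.Σ< f n ≡ sumL f n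
Σ<≡sumL f zero    = refl
Σ<≡sumL f (suc n) = cong (λ A → addL A (f n)) (Σ<≡sumL f n)

sumL-cong : ∀ {f g} n → (∀ i → i < n → f i ≈L g i) → sumL f n ≈L sumL g n
sumL-cong {f} {g} n f≈g = subst₂ _≈L_ (Σ<≡sumL f n) (Σ<≡sumL g n) (LaurentDilation.Σ<-cong n f≈g)

mulLS-dilate : ∀ t f g N → mulLS (dilateL t f) (dilateL t g) N ≈L dilateL t (mulLS f g) N
mulLS-dilate t f g N =
  subst₂ _≈L_ (Σ<≡sumL _ (suc N)) (if-cong-then (N % suc t ≡ᵇ 0) (Σ<≡sumL _ (suc (N / suc t))))
    (LaurentDilation.conv-dilate t f g N)

-- The terms T_n

sumℚ-monoS-≥ : ∀ k (h : ℕ → ℚ) M → M ≤ k → sumℚ (λ j → monoS k 1ℚ j ℚ.* h j) M ≡ 0ℚ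
sumℚ-monoS-≥ k h zero    _   = refl
sumℚ-monoS-≥ k h (suc M) M<k
  rewrite sumℚ-monoS-≥ k h M (ℕP.<⇒≤ M<k) | ≢⇒≡ᵇ≡false M k (ℕP.<⇒≢ M<k) =
  solve 1 (λ x → con 0ℚ :+ con 0ℚ :* x := con 0ℚ) refl (h M)

sumℚ-monoS-< : ∀ k (h : ℕ → ℚ) M → k < M → sumℚ (λ j → monoS k 1ℚ j ℚ.* h j) M ≡ h k
sumℚ-monoS-< k h (suc M) k<1+M with ℕP.m≤n⇒m<n∨m≡n (ℕP.≤-pred k<1+M)
... | inj₁ k<M rewrite sumℚ-monoS-< k h M k<M | ≢⇒≡ᵇ≡false M k (ℕP.<⇒≢ k<M ∘ sym) =
  solve 2 (λ x y → x :+ con 0ℚ :* y := x) refl (h k) (h M)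
... | inj₂ refl rewrite sumℚ-monoS-≥ k h k ℕP.≤-refl | ≡ᵇ-refl k =
  solve 1 (λ x → con 0ℚ :+ con 1ℚ :* x := x) refl (h k)

weight--ʷ : ∀ (f g : ℤ → ℚ) A → weight (λ m → f m ℚ.- g m) A ≡ weight f A ℚ.- weight g A
weight--ʷ f g (laurent s p) = go (λ i → f (+ i ℤ.- + s)) (λ i → g (+ i ℤ.- + s)) p
  where
  go : ∀ f g p → weightP (λ i → f i ℚ.- g i) p ≡ weightP f p ℚ.- weightP g p
  go f g []      = solve 0 (con 0ℚ := con 0ℚ :- con 0ℚ) refl
  go f g (a ∷ p) rewrite go (λ i → f (suc i)) (λ i → g (suc i)) p =
    solve 5 (λ x y a u v → (x :- y) :* a :+ (u :- v) := (x :* a :+ u) :- (y :* a :+ v)) refl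
      (f 0) (g 0) a (weightP (λ i → f (suc i)) p) (weightP (λ i → g (suc i)) p)

-- 2 w(d) − w(d − 1) − w(d + 1), written with the shifts  e ℤ.+ d  produced by weight-mulL
negSecondDiff : (ℤ → ℚ) → ℤ → ℚ
negSecondDiff w d = (w (+ 0 ℤ.+ d) ℚ.- w (-[1+ 0 ] ℤ.+ d)) ℚ.- (w (+ 1 ℤ.+ d) ℚ.- w (+ 0 ℤ.+ d))

T-numerator : Laurent
T-numerator = mulL (addL oneL (negL zL)) (addL oneL (negL zinvL))

weight-T-numerator : ∀ v → weight v T-numerator ≡ (v (+ 0) ℚ.- v -[1+ 0 ]) ℚ.- (v (+ 1) ℚ.- v (+ 0))
weight-T-numerator v =
  trans (weight-mulL v (addL oneL (negL zL)) (addL oneL (negL zinvL)))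
    (trans (weight-1-x zL (+ 1) weight-zL (λ d → weight (λ m → v (d ℤ.+ m)) (addL oneL (negL zinvL))))
           (cong₂ ℚ._-_ (weight-1-x zinvL -[1+ 0 ] weight-zinvL (λ m → v (+ 0 ℤ.+ m)))
                        (weight-1-x zinvL -[1+ 0 ] weight-zinvL (λ m → v (+ 1 ℤ.+ m)))))
  where
  weight-1-x : ∀ x e → (∀ u → weight u x ≡ u e) → ∀ u → weight u (addL oneL (negL x)) ≡ u (+ 0) ℚ.- u e
  weight-1-x x e weight-x u =
    trans (weight-addL u oneL (negL x)) (cong₂ ℚ._+_ (weight-oneL u) (trans (weight-negL u x) (cong ℚ.-_ (weight-x u))))

weight-T-numerator-mulL : ∀ w B → weight w (mulL T-numerator B) ≡ weight (negSecondDiff w) B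
weight-T-numerator-mulL w B = begin
  weight w (mulL T-numerator B)                 ≡⟨ weight-mulL w T-numerator B ⟩
  weight v T-numerator                          ≡⟨ weight-T-numerator v ⟩
  (v (+ 0) ℚ.- v -[1+ 0 ]) ℚ.- (v (+ 1) ℚ.- v (+ 0))
    ≡⟨ cong₂ ℚ._-_ (sym (weight--ʷ (shift (+ 0)) (shift -[1+ 0 ]) B)) (sym (weight--ʷ (shift (+ 1)) (shift (+ 0)) B)) ⟩
  weight (λ m → shift (+ 0) m ℚ.- shift -[1+ 0 ] m) B ℚ.- weight (λ m → shift (+ 1) m ℚ.- shift (+ 0) m) B
    ≡⟨ sym (weight--ʷ (λ m → shift (+ 0) m ℚ.- shift -[1+ 0 ] m) (λ m → shift (+ 1) m ℚ.- shift (+ 0) m) B) ⟩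
  weight (negSecondDiff w) B ∎
  where
  open ≡-Reasoning
  shift : ℤ → ℤ → ℚ
  shift d m = w (d ℤ.+ m)
  v : ℤ → ℚ
  v d = weight (shift d) B

T-inverseDenominator : LSeries
T-inverseDenominator = mulLS (powL zL) (powL zinvL)

-- Σ_{i ≤ c} f (2 i − c): the sum of f over −c, 2 − c, …, c.
symSum : (ℤ → ℚ) → ℕ → ℚ
symSum f c = sumℚ (λ i → f (+ i ℤ.- + (c ∸ i))) (suc c)

weight-T-inverseDenominator : ∀ w c → weight w (T-inverseDenominator c) ≡ symSum w c
weight-T-inverseDenominator w c =
  trans (weight-sumL w (λ i → mulL (powL zL i) (powL zinvL (c ∸ i))) (suc c))
    (sumℚ-cong (suc c) λ i _ →
      trans (weight-mulL w (powL zL i) (powL zinvL (c ∸ i)))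
        (trans (weight-powL-zL (λ d → weight (λ m → w (d ℤ.+ m)) (powL zinvL (c ∸ i))) i)
               (weight-powL-zinvL (λ m → w (+ i ℤ.+ m)) (c ∸ i))))

T₁ : LSeries
T₁ = mulLS (monoLS 1 T-numerator) T-inverseDenominator

weight-mulLS-monoLS : ∀ w n x g N →
  weight w (mulLS (monoLS n x) g N) ≡ sumℚ (λ j → monoS n 1ℚ j ℚ.* weight w (mulL x (g (N ∸ j)))) (suc N)
weight-mulLS-monoLS w n x g N =
  trans (weight-sumL w (λ j → mulL (monoLS n x j) (g (N ∸ j))) (suc N)) (sumℚ-cong (suc N) (λ j _ → term j))
  where
  term : ∀ j → weight w (mulL (monoLS n x j) (g (N ∸ j))) ≡ monoS n 1ℚ j ℚ.* weight w (mulL x (g (N ∸ j)))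
  term j with j ≡ᵇ n
  ... | true  = sym (ℚP.*-identityˡ _)
  ... | false = sym (ℚP.*-zeroˡ (weight w (mulL x (g (N ∸ j)))))

weight-T₁-zero : ∀ w → weight w (T₁ 0) ≡ 0ℚ
weight-T₁-zero w = trans (weight-mulLS-monoLS w 1 T-numerator T-inverseDenominator 0) (sumℚ-monoS-≥ 1 (λ j → weight w (mulL T-numerator (T-inverseDenominator (0 ∸ j)))) 1 ℕP.≤-refl)

weight-T₁-suc : ∀ w c → weight w (T₁ (suc c)) ≡ symSum (negSecondDiff w) c
weight-T₁-suc w c = begin
  weight w (T₁ (suc c))
    ≡⟨ weight-mulLS-monoLS w 1 T-numerator T-inverseDenominator (suc c) ⟩
  sumℚ (λ j → monoS 1 1ℚ j ℚ.* weight w (mulL T-numerator (T-inverseDenominator (suc c ∸ j)))) (suc (suc c))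
    ≡⟨ sumℚ-monoS-< 1 _ (suc (suc c)) (s≤s (s≤s z≤n)) ⟩
  weight w (mulL T-numerator (T-inverseDenominator c))
    ≡⟨ weight-T-numerator-mulL w (T-inverseDenominator c) ⟩
  weight (negSecondDiff w) (T-inverseDenominator c)
    ≡⟨ weight-T-inverseDenominator (negSecondDiff w) c ⟩
  symSum (negSecondDiff w) c ∎
  where open ≡-Reasoning

weight-termT : ∀ w t N → weight w (termT t N) ≡ dilateℚ t (λ c → weight w (T₁ c)) N
weight-termT w t N = begin
  weight w (termT t N)
    ≡⟨ weight-≡ (sumL-cong (suc N) (λ j _ → mulL-cong (numerator-dilates j) (mulLS-dilate t (powL zL) (powL zinvL) (N ∸ j)))) w ⟩
  weight w (mulLS (dilateL t (monoLS 1 T-numerator)) (dilateL t T-inverseDenominator) N)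
    ≡⟨ weight-≡ (mulLS-dilate t (monoLS 1 T-numerator) T-inverseDenominator N) w ⟩
  weight w (dilateL t T₁ N)
    ≡⟨ weight-dilateL w t T₁ N ⟩
  dilateℚ t (λ c → weight w (T₁ c)) N ∎
  where
  open ≡-Reasoning
  numerator-dilates : ∀ j → monoLS (suc t) T-numerator j ≈L dilateL t (monoLS 1 T-numerator) j
  numerator-dilates j = ≡⇒≈L (monomial-dilate T-numerator zeroL t 1 (suc t) j (sym (ℕP.*-identityˡ (suc t))))

-- Binomial weights

binomWeight : ℕ → ℕ → ℤ → ℚ
binomWeight s r m = binomℚ (ℤ→ℚ (m ℤ.+ + s)) r

symSum-zero : ∀ f → symSum f 0 ≡ f (+ 0)
symSum-zero f = ℚP.+-identityˡ (f (+ 0))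

symSum-one : ∀ f → symSum f 1 ≡ f -[1+ 0 ] ℚ.+ f (+ 1)
symSum-one f = cong (ℚ._+ f (+ 1)) (ℚP.+-identityˡ (f -[1+ 0 ]))

symSum-suc-suc : ∀ f c → symSum f (suc (suc c)) ≡ symSum f c ℚ.+ f (+ suc (suc c)) ℚ.+ f (- + suc (suc c))
symSum-suc-suc f c = begin
  sumℚ g (suc (suc (suc c)))
    ≡⟨ sumℚ-suc g (suc (suc c)) ⟩
  g 0 ℚ.+ (sumℚ (λ i → g (suc i)) (suc c) ℚ.+ g (suc (suc c)))
    ≡⟨ cong₂ (λ a b → a ℚ.+ (b ℚ.+ g (suc (suc c)))) (cong f (ℤP.+-identityˡ (- + suc (suc c))))
             (sumℚ-cong (suc c) (λ i i≤c → cong f (inner i (ℕP.≤-pred i≤c)))) ⟩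
  f (- + suc (suc c)) ℚ.+ (symSum f c ℚ.+ g (suc (suc c)))
    ≡⟨ cong (λ x → f (- + suc (suc c)) ℚ.+ (symSum f c ℚ.+ f (+ suc (suc c) ℤ.- + x))) (ℕP.n∸n≡0 c) ⟩
  f (- + suc (suc c)) ℚ.+ (symSum f c ℚ.+ f (+ suc (suc c) ℤ.- + 0))
    ≡⟨ cong (λ x → f (- + suc (suc c)) ℚ.+ (symSum f c ℚ.+ f x)) (ℤP.+-identityʳ (+ suc (suc c))) ⟩
  f (- + suc (suc c)) ℚ.+ (symSum f c ℚ.+ f (+ suc (suc c)))
    ≡⟨ solve 3 (λ a b x → a :+ (b :+ x) := b :+ x :+ a) refl (f (- + suc (suc c))) (symSum f c) (f (+ suc (suc c))) ⟩
  symSum f c ℚ.+ f (+ suc (suc c)) ℚ.+ f (- + suc (suc c)) ∎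
  where
  open ≡-Reasoning
  g : ℕ → ℚ
  g i = f (+ i ℤ.- + (suc (suc c) ∸ i))
  inner : ∀ i → i ≤ c → + suc i ℤ.- + (suc c ∸ i) ≡ + i ℤ.- + (c ∸ i)
  inner i i≤c = begin
    + suc i ℤ.- + (suc c ∸ i)         ≡⟨ cong (λ x → + suc i ℤ.- + x) (ℕP.+-∸-assoc 1 i≤c) ⟩
    + (1 + i) ℤ.- + (1 + (c ∸ i))     ≡⟨ cong₂ ℤ._-_ (ℤP.pos-+ 1 i) (ℤP.pos-+ 1 (c ∸ i)) ⟩
    (+ 1 ℤ.+ + i) ℤ.- (+ 1 ℤ.+ + (c ∸ i)) ≡⟨ [a+b]-[a+c]≡b-c (+ 1) (+ i) (+ (c ∸ i)) ⟩
    + i ℤ.- + (c ∸ i)                 ∎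

symSum-odd : ∀ f → (∀ d → f (- d) ≡ ℚ.- f d) → ∀ c → symSum f c ≡ 0ℚ
symSum-odd f f-odd zero          = trans (symSum-zero f) (x≡-x⇒x≡0 (f (+ 0)) (f-odd (+ 0)))
symSum-odd f f-odd (suc zero)    =
  trans (symSum-one f) (trans (cong (ℚ._+ f (+ 1)) (f-odd (+ 1))) (ℚP.+-inverseˡ (f (+ 1))))
symSum-odd f f-odd (suc (suc c)) = begin
  symSum f (suc (suc c))                       ≡⟨ symSum-suc-suc f c ⟩
  symSum f c ℚ.+ f d ℚ.+ f (- d)               ≡⟨ cong₂ (λ a b → a ℚ.+ f d ℚ.+ b) (symSum-odd f f-odd c) (f-odd d) ⟩
  0ℚ ℚ.+ f d ℚ.- f d                           ≡⟨ solve 1 (λ x → con 0ℚ :+ x :- x := con 0ℚ) refl (f d) ⟩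
  0ℚ                                           ∎
  where
  open ≡-Reasoning
  d = + suc (suc c)

a+-d≡-[-a+d] : ∀ a d → a ℤ.+ - d ≡ - (- a ℤ.+ d)
a+-d≡-[-a+d] = ℤRing.solve-∀

negSecondDiff-odd : ∀ w → (∀ m → w (- m) ≡ ℚ.- w m) → ∀ d → negSecondDiff w (- d) ≡ ℚ.- negSecondDiff w d
negSecondDiff-odd w w-odd d = begin
  (w (+ 0 ℤ.+ - d) ℚ.- w (-[1+ 0 ] ℤ.+ - d)) ℚ.- (w (+ 1 ℤ.+ - d) ℚ.- w (+ 0 ℤ.+ - d))
    ≡⟨ cong₂ (λ a b → (a ℚ.- b) ℚ.- (c′ ℚ.- a)) (w-neg (+ 0)) (w-neg -[1+ 0 ]) ⟩
  (ℚ.- a ℚ.- ℚ.- c) ℚ.- (c′ ℚ.- ℚ.- a)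
    ≡⟨ cong (λ x → (ℚ.- a ℚ.- ℚ.- c) ℚ.- (x ℚ.- ℚ.- a)) (w-neg (+ 1)) ⟩
  (ℚ.- a ℚ.- ℚ.- c) ℚ.- (ℚ.- b ℚ.- ℚ.- a)
    ≡⟨ solve 3 (λ a b c → (:- a :- :- c) :- (:- b :- :- a) := :- ((a :- b) :- (c :- a))) refl a b c ⟩
  ℚ.- negSecondDiff w d ∎
  where
  open ≡-Reasoning
  a = w (+ 0 ℤ.+ d)
  b = w (-[1+ 0 ] ℤ.+ d)
  c = w (+ 1 ℤ.+ d)
  c′ = w (+ 1 ℤ.+ - d)
  w-neg : ∀ e → w (e ℤ.+ - d) ≡ ℚ.- w (- e ℤ.+ d)
  w-neg e = trans (cong w (a+-d≡-[-a+d] e d)) (w-odd (- e ℤ.+ d))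

binomWeight-odd : ∀ k m → binomWeight k (suc (k + k)) (- m) ≡ ℚ.- binomWeight k (suc (k + k)) m
binomWeight-odd k m = begin
  binomℚ y r                      ≡⟨ binom-reflect r y c y+c≡r-1 ⟩
  sign r ℚ.* binomℚ c r           ≡⟨ cong (λ s → ℚ.- s ℚ.* binomℚ c r) (sign-even k) ⟩
  ℚ.- 1ℚ ℚ.* binomℚ c r           ≡⟨ solve 1 (λ x → (:- con 1ℚ) :* x := :- x) refl (binomℚ c r) ⟩
  ℚ.- binomℚ c r                  ∎
  where
  open ≡-Reasoning
  r = suc (k + k)
  y = ℤ→ℚ (- m ℤ.+ + k)
  c = ℤ→ℚ (m ℤ.+ + k)
  y+c≡r-1 : y ℚ.+ c ≡ ℕ→ℚ r ℚ.- 1ℚ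
  y+c≡r-1 = begin
    ℤ→ℚ (- m ℤ.+ + k) ℚ.+ ℤ→ℚ (m ℤ.+ + k)
      ≡⟨ cong₂ ℚ._+_ (trans (ℤ→ℚ-+ (- m) (+ k)) (cong (ℚ._+ ℕ→ℚ k) (ℤ→ℚ-neg m))) (ℤ→ℚ-+ m (+ k)) ⟩
    (ℚ.- ℤ→ℚ m ℚ.+ ℕ→ℚ k) ℚ.+ (ℤ→ℚ m ℚ.+ ℕ→ℚ k)
      ≡⟨ solve 2 (λ m k → (:- m :+ k) :+ (m :+ k) := k :+ k :+ con 1ℚ :- con 1ℚ) refl (ℤ→ℚ m) (ℕ→ℚ k) ⟩
    ℕ→ℚ k ℚ.+ ℕ→ℚ k ℚ.+ 1ℚ ℚ.- 1ℚ
      ≡⟨ cong (ℚ._- 1ℚ) (ℕ→ℚ-1+c+k k k) ⟨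
    ℕ→ℚ r ℚ.- 1ℚ ∎

negSecondDiff-binomWeight : ∀ s r d →
  negSecondDiff (binomWeight s (suc (suc r))) d ≡ ℚ.- binomℚ (ℤ→ℚ d ℚ.+ ℕ→ℚ s ℚ.- 1ℚ) r
negSecondDiff-binomWeight s r d = begin
  (B (arg (+ 0)) ℚ.- B (arg -[1+ 0 ])) ℚ.- (B (arg (+ 1)) ℚ.- B (arg (+ 0)))
    ≡⟨ cong₃ (λ a b c → (B a ℚ.- B b) ℚ.- (B c ℚ.- B a))
         (arg≡ (+ 0)    (solve 1 (λ y → con 0ℚ :+ y := y) refl y))
         (arg≡ -[1+ 0 ] (solve 1 (λ y → (:- con 1ℚ) :+ y := y :- con 1ℚ) refl y))
         (arg≡ (+ 1)    (solve 1 (λ y → con 1ℚ :+ y := y :+ con 1ℚ) refl y)) ⟩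
  (B y ℚ.- B (y ℚ.- 1ℚ)) ℚ.- (B (y ℚ.+ 1ℚ) ℚ.- B y)
    ≡⟨ binom-secondDiff y r ⟩
  ℚ.- binomℚ (y ℚ.- 1ℚ) r ∎
  where
  open ≡-Reasoning
  B = λ x → binomℚ x (suc (suc r))
  y = ℤ→ℚ d ℚ.+ ℕ→ℚ s
  arg : ℤ → ℚ
  arg a = ℤ→ℚ ((a ℤ.+ d) ℤ.+ + s)
  arg≡ : ∀ a {x} → ℤ→ℚ a ℚ.+ y ≡ x → arg a ≡ x
  arg≡ a eq = trans (trans (ℤ→ℚ-+ (a ℤ.+ d) (+ s)) (trans (cong (ℚ._+ ℕ→ℚ s) (ℤ→ℚ-+ a d)) (ℚP.+-assoc (ℤ→ℚ a) (ℤ→ℚ d) (ℕ→ℚ s)))) eq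
  cong₃ : ∀ {A : Set} (f : ℚ → ℚ → ℚ → A) {a a′ b b′ c c′} → a ≡ a′ → b ≡ b′ → c ≡ c′ → f a b c ≡ f a′ b′ c′
  cong₃ f refl refl refl = refl

binom-even-symmetric : ∀ k y c → y ℚ.+ c ≡ ℕ→ℚ (k + k) ℚ.- 1ℚ → binomℚ y (k + k) ≡ binomℚ c (k + k)
binom-even-symmetric k y c y+c≡2k-1 =
  trans (binom-reflect (k + k) y c y+c≡2k-1)
    (trans (cong (ℚ._* binomℚ c (k + k)) (sign-even k)) (ℚP.*-identityˡ (binomℚ c (k + k))))

binom-pascal² : ∀ x r → binomℚ (x ℚ.+ 1ℚ ℚ.+ 1ℚ) (suc r) ≡ binomℚ x (suc r) ℚ.+ binomℚ x r ℚ.+ binomℚ (x ℚ.+ 1ℚ) r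
binom-pascal² x r = trans (binom-pascal (x ℚ.+ 1ℚ) r) (cong (ℚ._+ binomℚ (x ℚ.+ 1ℚ) r) (binom-pascal x r))

module ShiftedBinomialSum (k : ℕ) where

  private
    κ = ℕ→ℚ k
    r = k + k

    symmetric : ∀ y c → y ℚ.+ c ≡ κ ℚ.+ κ ℚ.- 1ℚ → binomℚ y r ≡ binomℚ c r
    symmetric y c eq = binom-even-symmetric k y c (trans eq (cong (ℚ._- 1ℚ) (sym (ℕ→ℚ-+ k k))))

    binom-κ : binomℚ (κ ℚ.+ 1ℚ) (suc r) ≡ binomℚ κ r
    binom-κ = trans (binom-pascal κ r)
                (trans (cong (ℚ._+ binomℚ κ r) (binom-vanish k (suc r) (s≤s (ℕP.m≤m+n k k))))
                       (ℚP.+-identityˡ (binomℚ κ r)))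

  summand : ℤ → ℚ
  summand d = binomℚ (ℤ→ℚ d ℚ.+ κ ℚ.- 1ℚ) r

  closedForm : ℕ → ℚ
  closedForm c = binomℚ (ℕ→ℚ c ℚ.+ κ ℚ.+ 1ℚ) (suc r)

  closedForm-zero : closedForm 0 ≡ summand (+ 0)
  closedForm-zero = begin
    binomℚ (0ℚ ℚ.+ κ ℚ.+ 1ℚ) (suc r) ≡⟨ binom-cong (suc r) (solve 1 (λ x → con 0ℚ :+ x :+ con 1ℚ := x :+ con 1ℚ) refl κ) ⟩
    binomℚ (κ ℚ.+ 1ℚ) (suc r)        ≡⟨ binom-κ ⟩
    binomℚ κ r                       ≡⟨ symmetric (0ℚ ℚ.+ κ ℚ.- 1ℚ) κ (solve 1 (λ x → con 0ℚ :+ x :- con 1ℚ :+ x := x :+ x :- con 1ℚ) refl κ) ⟨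
    summand (+ 0)                          ∎
    where open ≡-Reasoning

  closedForm-one : closedForm 1 ≡ summand -[1+ 0 ] ℚ.+ summand (+ 1)
  closedForm-one = begin
    binomℚ (1ℚ ℚ.+ κ ℚ.+ 1ℚ) (suc r)
      ≡⟨ binom-cong (suc r) (solve 1 (λ x → con 1ℚ :+ x :+ con 1ℚ := x :+ con 1ℚ :+ con 1ℚ) refl κ) ⟩
    binomℚ (κ ℚ.+ 1ℚ ℚ.+ 1ℚ) (suc r)
      ≡⟨ binom-pascal (κ ℚ.+ 1ℚ) r ⟩
    binomℚ (κ ℚ.+ 1ℚ) (suc r) ℚ.+ binomℚ (κ ℚ.+ 1ℚ) r
      ≡⟨ cong (ℚ._+ binomℚ (κ ℚ.+ 1ℚ) r) binom-κ ⟩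
    binomℚ κ r ℚ.+ binomℚ (κ ℚ.+ 1ℚ) r
      ≡⟨ ℚP.+-comm (binomℚ κ r) (binomℚ (κ ℚ.+ 1ℚ) r) ⟩
    binomℚ (κ ℚ.+ 1ℚ) r ℚ.+ binomℚ κ r
      ≡⟨ cong₂ ℚ._+_
           (symmetric (ℤ→ℚ -[1+ 0 ] ℚ.+ κ ℚ.- 1ℚ) (κ ℚ.+ 1ℚ)
              (solve 1 (λ x → (:- con 1ℚ) :+ x :- con 1ℚ :+ (x :+ con 1ℚ) := x :+ x :- con 1ℚ) refl κ))
           (binom-cong r (solve 1 (λ x → con 1ℚ :+ x :- con 1ℚ := x) refl κ)) ⟨
    summand -[1+ 0 ] ℚ.+ summand (+ 1) ∎
    where open ≡-Reasoning

  closedForm-suc-suc : ∀ c → closedForm (suc (suc c)) ≡ closedForm c ℚ.+ summand (+ suc (suc c)) ℚ.+ summand (- + suc (suc c))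
  closedForm-suc-suc c = begin
    binomℚ (ℕ→ℚ (suc (suc c)) ℚ.+ κ ℚ.+ 1ℚ) (suc r)
      ≡⟨ binom-cong (suc r) (trans (cong (λ x → x ℚ.+ κ ℚ.+ 1ℚ) [2+c])
           (solve 2 (λ a x → a :+ con 1ℚ :+ con 1ℚ :+ x :+ con 1ℚ := a :+ x :+ con 1ℚ :+ con 1ℚ :+ con 1ℚ) refl (ℕ→ℚ c) κ)) ⟩
    binomℚ (z ℚ.+ 1ℚ ℚ.+ 1ℚ) (suc r)
      ≡⟨ binom-pascal² z r ⟩
    closedForm c ℚ.+ binomℚ z r ℚ.+ binomℚ (z ℚ.+ 1ℚ) r
      ≡⟨ cong₂ (λ a b → closedForm c ℚ.+ a ℚ.+ b)
           (binom-cong r (trans (solve 2 (λ a x → a :+ x :+ con 1ℚ := a :+ con 1ℚ :+ con 1ℚ :+ x :- con 1ℚ) refl (ℕ→ℚ c) κ)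
                                (cong (λ x → x ℚ.+ κ ℚ.- 1ℚ) (sym [2+c]))))
           (sym (symmetric (ℤ→ℚ (- + suc (suc c)) ℚ.+ κ ℚ.- 1ℚ) (z ℚ.+ 1ℚ)
                  (trans (cong (λ x → x ℚ.+ κ ℚ.- 1ℚ ℚ.+ (z ℚ.+ 1ℚ)) (trans (ℤ→ℚ-neg (+ suc (suc c))) (cong ℚ.-_ [2+c])))
                    (solve 2 (λ a x → :- (a :+ con 1ℚ :+ con 1ℚ) :+ x :- con 1ℚ :+ (a :+ x :+ con 1ℚ :+ con 1ℚ)
                                    := x :+ x :- con 1ℚ) refl (ℕ→ℚ c) κ)))) ⟩
    closedForm c ℚ.+ summand (+ suc (suc c)) ℚ.+ summand (- + suc (suc c)) ∎
    where
    open ≡-Reasoning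
    z = ℕ→ℚ c ℚ.+ κ ℚ.+ 1ℚ
    [2+c] : ℕ→ℚ (suc (suc c)) ≡ ℕ→ℚ c ℚ.+ 1ℚ ℚ.+ 1ℚ
    [2+c] = trans (ℕ→ℚ-suc (suc c)) (cong (ℚ._+ 1ℚ) (ℕ→ℚ-suc c))

  symSum-summand : ∀ c → symSum summand c ≡ closedForm c
  symSum-summand zero          = trans (symSum-zero summand) (sym closedForm-zero)
  symSum-summand (suc zero)    = trans (symSum-one summand) (sym closedForm-one)
  symSum-summand (suc (suc c)) =
    trans (symSum-suc-suc summand c)
      (trans (cong (λ x → x ℚ.+ summand (+ suc (suc c)) ℚ.+ summand (- + suc (suc c))) (symSum-summand c)) (sym (closedForm-suc-suc c)))

-- The right-hand side

ones : Series
ones _ = 1ℚ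

mulS-ones-suc : ∀ g N → mulS ones g (suc N) ≡ g (suc N) ℚ.+ mulS ones g N
mulS-ones-suc g N =
  trans (sumℚ-suc (λ j → 1ℚ ℚ.* g (suc N ∸ j)) (suc N)) (cong (ℚ._+ mulS ones g N) (ℚP.*-identityˡ (g (suc N))))

mulS-ones-zero : ∀ g → mulS ones g 0 ≡ g 0
mulS-ones-zero g = solve 1 (λ x → con 0ℚ :+ con 1ℚ :* x := x) refl (g 0)

powS-ones : ∀ m N → powS ones (suc m) N ≡ binomℚ (ℕ→ℚ (N + m)) m
powS-ones zero    zero    = mulS-ones-zero oneS
powS-ones zero    (suc N) = trans (mulS-ones-suc oneS N) (trans (ℚP.+-identityˡ _) (powS-ones zero N))
powS-ones (suc m) zero    = begin
  mulS ones (powS ones (suc m)) 0         ≡⟨ mulS-ones-zero (powS ones (suc m)) ⟩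
  powS ones (suc m) 0                     ≡⟨ powS-ones m 0 ⟩
  binomℚ x m                              ≡⟨ ℚP.+-identityˡ (binomℚ x m) ⟨
  0ℚ ℚ.+ binomℚ x m                       ≡⟨ cong (ℚ._+ binomℚ x m) (binom-vanish m (suc m) ℕP.≤-refl) ⟨
  binomℚ x (suc m) ℚ.+ binomℚ x m         ≡⟨ binom-pascal x m ⟨
  binomℚ (x ℚ.+ 1ℚ) (suc m)               ≡⟨ binom-cong (suc m) (ℕ→ℚ-suc m) ⟨
  binomℚ (ℕ→ℚ (suc m)) (suc m)            ∎
  where
  open ≡-Reasoning
  x = ℕ→ℚ m
powS-ones (suc m) (suc N) = begin
  mulS ones (powS ones (suc m)) (suc N)
    ≡⟨ mulS-ones-suc (powS ones (suc m)) N ⟩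
  powS ones (suc m) (suc N) ℚ.+ powS ones (suc (suc m)) N
    ≡⟨ cong₂ ℚ._+_ (trans (powS-ones m (suc N)) (binom-cong m (cong ℕ→ℚ (sym (ℕP.+-suc N m))))) (powS-ones (suc m) N) ⟩
  binomℚ x m ℚ.+ binomℚ x (suc m)
    ≡⟨ ℚP.+-comm (binomℚ x m) (binomℚ x (suc m)) ⟩
  binomℚ x (suc m) ℚ.+ binomℚ x m
    ≡⟨ binom-pascal x m ⟨
  binomℚ (x ℚ.+ 1ℚ) (suc m)
    ≡⟨ binom-cong (suc m) (ℕ→ℚ-suc (N + suc m)) ⟨
  binomℚ (ℕ→ℚ (suc N + suc m)) (suc m) ∎
  where
  open ≡-Reasoning
  x = ℕ→ℚ (N + suc m)

powS-geomS : ∀ t m N → powS (geomS t) m N ≡ dilateℚ t (powS ones m) N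
powS-geomS t zero    N = monomial-dilate 1ℚ 0ℚ t 0 0 N refl
powS-geomS t (suc m) N = trans (mulS-cong (geomS t) N (powS-geomS t m)) (mulS-dilate t ones (powS ones m) N)

rhsTerm-dilate : ∀ t k N → mulS (monoS (suc t * k) 1ℚ) (powS (geomS t) (2 * k)) N
                         ≡ dilateℚ t (mulS (monoS k 1ℚ) (powS ones (2 * k))) N
rhsTerm-dilate t k N =
  trans (sumℚ-cong (suc N) (λ j _ → cong₂ ℚ._*_ (monomial-dilate 1ℚ 0ℚ t k (suc t * k) j (ℕP.*-comm (suc t) k))
                                               (powS-geomS t (2 * k) (N ∸ j))))
        (mulS-dilate t (monoS k 1ℚ) (powS ones (2 * k)) N)

-- the coefficient of q^c in q^(k+1) / (1 − q)^(2k+2)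
rhsCoeff : ℕ → ℕ → ℚ
rhsCoeff k c = mulS (monoS (suc k) 1ℚ) (powS ones (2 * suc k)) c

rhsCoeff-zero : ∀ k → rhsCoeff k 0 ≡ 0ℚ
rhsCoeff-zero k = sumℚ-monoS-≥ (suc k) (λ j → powS ones (2 * suc k) (0 ∸ j)) 1 (s≤s z≤n)

rhsCoeff-suc : ∀ k c → rhsCoeff k (suc c) ≡ ShiftedBinomialSum.closedForm k c
rhsCoeff-suc k c with k ℕP.≤? c
... | yes k≤c = begin
  rhsCoeff k (suc c)
    ≡⟨ sumℚ-monoS-< (suc k) (λ j → powS ones (2 * suc k) (suc c ∸ j)) (suc (suc c)) (s≤s (s≤s k≤c)) ⟩
  powS ones (2 * suc k) (c ∸ k)
    ≡⟨ powS-ones m (c ∸ k) ⟩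
  binomℚ (ℕ→ℚ (c ∸ k + m)) m
    ≡⟨ cong₂ (λ x r → binomℚ (ℕ→ℚ x) r) c∸k+m≡1+c+k m≡1+2k ⟩
  binomℚ (ℕ→ℚ (suc (c + k))) (suc (k + k))
    ≡⟨ binom-cong (suc (k + k)) (ℕ→ℚ-1+c+k c k) ⟩
  ShiftedBinomialSum.closedForm k c ∎
  where
  open ≡-Reasoning
  m = k + suc (k + 0)
  m≡1+2k : m ≡ suc (k + k)
  m≡1+2k = trans (ℕP.+-suc k (k + 0)) (cong (λ x → suc (k + x)) (ℕP.+-identityʳ k))
  c∸k+m≡1+c+k : c ∸ k + m ≡ suc (c + k)
  c∸k+m≡1+c+k = begin
    c ∸ k + m           ≡⟨ cong (λ x → c ∸ k + x) m≡1+2k ⟩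
    c ∸ k + suc (k + k) ≡⟨ ℕP.+-suc (c ∸ k) (k + k) ⟩
    suc (c ∸ k + (k + k)) ≡⟨ cong suc (ℕP.+-assoc (c ∸ k) k k) ⟨
    suc (c ∸ k + k + k) ≡⟨ cong (λ x → suc (x + k)) (ℕP.m∸n+n≡m k≤c) ⟩
    suc (c + k)         ∎
... | no k≰c = begin
  rhsCoeff k (suc c)
    ≡⟨ sumℚ-monoS-≥ (suc k) (λ j → powS ones (2 * suc k) (suc c ∸ j)) (suc (suc c)) (s≤s (ℕP.≰⇒> k≰c)) ⟩
  0ℚ
    ≡⟨ binom-vanish (suc (c + k)) (suc (k + k)) (s≤s (ℕP.+-monoˡ-< k (ℕP.≰⇒> k≰c))) ⟨
  binomℚ (ℕ→ℚ (suc (c + k))) (suc (k + k))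
    ≡⟨ binom-cong (suc (k + k)) (ℕ→ℚ-1+c+k c k) ⟩
  ShiftedBinomialSum.closedForm k c ∎
  where open ≡-Reasoning

[a-b]+b≡a : ∀ a b → (a ℤ.- b) ℤ.+ b ≡ a
[a-b]+b≡a = ℤRing.solve-∀

2k+1≡1+[k+k] : ∀ k → 2 * k + 1 ≡ suc (k + k)
2k+1≡1+[k+k] = ℕRing.solve-∀

2[1+k]≡2+[k+k] : ∀ k → 2 * suc k ≡ suc (suc (k + k))
2[1+k]≡2+[k+k] = ℕRing.solve-∀

2[1+k]∸1≡1+k*2 : ∀ k → 2 * suc k ∸ 1 ≡ 1 + k * 2
2[1+k]∸1≡1+k*2 k = trans (ℕP.+-suc k (k + 0)) (cong suc (ℕP.*-comm 2 k))

η-X≡weight : ∀ P α k n → η-X P α k n ≡ weight (binomWeight ((k ∸ 1) / 2) k) (R-X P α n)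
η-X≡weight P α k n =
  trans (sumℚ-cong (length p) (λ i _ → cong (λ m → w (+ i ℤ.- + s) ℚ.* coeffAux p m) ([a-b]+b≡a (+ i) (+ s))))
        (weightP≡sumℚ (λ i → w (+ i ℤ.- + s)) p)
  where
  w = binomWeight ((k ∸ 1) / 2) k
  s = lshift (R-X P α n)
  p = lpoly (R-X P α n)

weight-constL-mulL : ∀ w c A → weight w (mulL (constL c) A) ≡ c ℚ.* weight w A
weight-constL-mulL w c A =
  trans (weight-mulL w (constL c) A)
    (trans (weight-constL (λ d → weight (λ m → w (d ℤ.+ m)) A) c)
      (trans (ℚP.*-comm _ c) (cong (c ℚ.*_) (weight-cong A (λ m → cong w (ℤP.+-identityˡ m))))))

weight-R-X : ∀ w P α n → weight w (R-X P α n) ≡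
  mulS P (λ N → weight w (oneLS N) ℚ.+ sumℚ (λ t → α (+ suc t) ℚ.* weight w (termT t N)) N) n
weight-R-X w P α n =
  trans (weight-sumL w (λ j → mulL (constL (P j)) (addL (oneLS (n ∸ j)) (sumαT α (n ∸ j)))) (suc n))
    (sumℚ-cong (suc n) λ j _ → trans (weight-constL-mulL w (P j) (addL (oneLS (n ∸ j)) (sumαT α (n ∸ j)))) (cong (P j ℚ.*_) (inner (n ∸ j))))
  where
  inner : ∀ N → weight w (addL (oneLS N) (sumαT α N)) ≡
                weight w (oneLS N) ℚ.+ sumℚ (λ t → α (+ suc t) ℚ.* weight w (termT t N)) N
  inner N = trans (weight-addL w (oneLS N) (sumαT α N))
              (cong (weight w (oneLS N) ℚ.+_)
                (trans (weight-sumL w (λ t → scaleL (α (+ suc t)) (termT t N)) N)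
                       (sumℚ-cong N (λ t _ → weight-scaleL w (α (+ suc t)) (termT t N)))))

weight-oneLS : ∀ w N → w (+ 0) ≡ 0ℚ → weight w (oneLS N) ≡ 0ℚ
weight-oneLS w zero    w0≡0 = trans (weight-oneL w) w0≡0
weight-oneLS w (suc N) w0≡0 = refl

mulS-zeroʳ : ∀ f N → mulS f (λ _ → 0ℚ) N ≡ 0ℚ
mulS-zeroʳ f N = sumℚ-vanish _ (suc N) (λ j _ → ℚP.*-zeroʳ (f j))

mulS-negʳ : ∀ f g N → mulS f (λ i → ℚ.- g i) N ≡ ℚ.- mulS f g N
mulS-negʳ f g N =
  trans (sumℚ-cong (suc N) (λ j _ → sym (ℚP.neg-distribʳ-* (f j) (g (N ∸ j)))))
        (sumℚ-neg (λ j → f j ℚ.* g (N ∸ j)) (suc N))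

η-X-odd : ∀ P α k n → η-X P α (2 * k + 1) n ≡ 0ℚ
η-X-odd P α k n = begin
  η-X P α (2 * k + 1) n
    ≡⟨ η-X≡weight P α (2 * k + 1) n ⟩
  weight (binomWeight ((2 * k + 1 ∸ 1) / 2) (2 * k + 1)) (R-X P α n)
    ≡⟨ cong₂ (λ s r → weight (binomWeight s r) (R-X P α n)) [2k+1-1]/2≡k (2k+1≡1+[k+k] k) ⟩
  weight w (R-X P α n)
    ≡⟨ weight-R-X w P α n ⟩
  mulS P (λ N → weight w (oneLS N) ℚ.+ sumℚ (λ t → α (+ suc t) ℚ.* weight w (termT t N)) N) n
    ≡⟨ mulS-cong P n (λ N → cong₂ ℚ._+_ (weight-oneLS w N w0≡0)
                                         (sumℚ-vanish _ N (λ t _ → trans (cong (α (+ suc t) ℚ.*_) (termT-vanish t N))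
                                                                        (ℚP.*-zeroʳ (α (+ suc t)))))) ⟩
  mulS P (λ _ → 0ℚ) n
    ≡⟨ mulS-zeroʳ P n ⟩
  0ℚ ∎
  where
  open ≡-Reasoning
  w = binomWeight k (suc (k + k))
  [2k+1-1]/2≡k : (2 * k + 1 ∸ 1) / 2 ≡ k
  [2k+1-1]/2≡k rewrite ℕP.m+n∸n≡m (2 * k) 1 | ℕP.*-comm 2 k = m*n/n≡m k 2
  w0≡0 : w (+ 0) ≡ 0ℚ
  w0≡0 = binom-vanish k (suc (k + k)) (s≤s (ℕP.m≤m+n k k))
  T₁-vanish : ∀ c → weight w (T₁ c) ≡ 0ℚ
  T₁-vanish zero    = weight-T₁-zero w
  T₁-vanish (suc c) = trans (weight-T₁-suc w c)
    (symSum-odd (negSecondDiff w) (negSecondDiff-odd w (binomWeight-odd k)) c)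
  termT-vanish : ∀ t N → weight w (termT t N) ≡ 0ℚ
  termT-vanish t N = trans (weight-termT w t N) (trans (dilateℚ-cong t N T₁-vanish) (dilateℚ-zero t N))

η-X-even : ∀ P α k n → η-X P α (2 * suc k) n ≡ ℚ.- mulS P (sumRHS α (suc k)) n
η-X-even P α k n = begin
  η-X P α (2 * suc k) n
    ≡⟨ η-X≡weight P α (2 * suc k) n ⟩
  weight (binomWeight ((2 * suc k ∸ 1) / 2) (2 * suc k)) (R-X P α n)
    ≡⟨ cong₂ (λ s r → weight (binomWeight s r) (R-X P α n)) [2k+2-1]/2≡k (2[1+k]≡2+[k+k] k) ⟩
  weight w (R-X P α n)
    ≡⟨ weight-R-X w P α n ⟩
  mulS P (λ N → weight w (oneLS N) ℚ.+ sumℚ (λ t → α (+ suc t) ℚ.* weight w (termT t N)) N) n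
    ≡⟨ mulS-cong P n (λ N → trans (cong₂ ℚ._+_ (weight-oneLS w N w0≡0) (sum-termT N)) (ℚP.+-identityˡ (ℚ.- sumRHS α (suc k) N))) ⟩
  mulS P (λ N → ℚ.- sumRHS α (suc k) N) n
    ≡⟨ mulS-negʳ P (sumRHS α (suc k)) n ⟩
  ℚ.- mulS P (sumRHS α (suc k)) n ∎
  where
  open ≡-Reasoning
  open ShiftedBinomialSum k using (symSum-summand)
  w = binomWeight k (suc (suc (k + k)))
  [2k+2-1]/2≡k : (2 * suc k ∸ 1) / 2 ≡ k
  [2k+2-1]/2≡k = trans (cong (_/ 2) (2[1+k]∸1≡1+k*2 k)) (trans (+-distrib-/-∣ʳ 1 {k * 2} {2} (divides k refl)) (m*n/n≡m k 2))
  w0≡0 : w (+ 0) ≡ 0ℚ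
  w0≡0 = binom-vanish k (suc (suc (k + k))) (s≤s (ℕP.m≤n⇒m≤1+n (ℕP.m≤m+n k k)))
  T₁-coeff : ∀ c → weight w (T₁ c) ≡ ℚ.- rhsCoeff k c
  T₁-coeff zero    = trans (weight-T₁-zero w) (cong ℚ.-_ (sym (rhsCoeff-zero k)))
  T₁-coeff (suc c) = begin
    weight w (T₁ (suc c))                   ≡⟨ weight-T₁-suc w c ⟩
    symSum (negSecondDiff w) c              ≡⟨ sumℚ-cong (suc c) (λ i _ → negSecondDiff-binomWeight k (k + k) (+ i ℤ.- + (c ∸ i))) ⟩
    symSum (λ d → ℚ.- ShiftedBinomialSum.summand k d) c ≡⟨ sumℚ-neg _ (suc c) ⟩
    ℚ.- symSum (ShiftedBinomialSum.summand k) c    ≡⟨ cong ℚ.-_ (trans (symSum-summand c) (sym (rhsCoeff-suc k c))) ⟩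
    ℚ.- rhsCoeff k (suc c)                  ∎
  termT-coeff : ∀ t N → weight w (termT t N) ≡
                ℚ.- mulS (monoS (suc t * suc k) 1ℚ) (powS (geomS t) (2 * suc k)) N
  termT-coeff t N =
    trans (weight-termT w t N)
      (trans (dilateℚ-cong t N T₁-coeff)
        (trans (dilateℚ-neg t (rhsCoeff k) N) (cong ℚ.-_ (sym (rhsTerm-dilate t (suc k) N)))))
  sum-termT : ∀ N → sumℚ (λ t → α (+ suc t) ℚ.* weight w (termT t N)) N ≡ ℚ.- sumRHS α (suc k) N
  sum-termT N =
    trans (sumℚ-cong N (λ t _ → trans (cong (α (+ suc t) ℚ.*_) (termT-coeff t N)) (sym (ℚP.neg-distribʳ-* (α (+ suc t)) (mulS (monoS (suc t * suc k) 1ℚ) (powS (geomS t) (2 * suc k)) N)))))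
          (sumℚ-neg _ N)

lemma3p2 : (α : ℤ → ℚ) → (∀ n → α n ≡ α (- n)) → (P : ℕ → ℚ) →
    ((k n : ℕ) → η-X P α (2 ℕ.* k ℕ.+ 1) n ≡ 0ℚ) ×
    ((k : ℕ) → 1 ≤ k → (n : ℕ) → 1 ≤ n →
      η-X P α (2 ℕ.* k) n ≡ ℚ.- mulS P (sumRHS α k) n)
lemma3p2 α _ P = η-X-odd P α , even
  where
  even : (k : ℕ) → 1 ≤ k → (n : ℕ) → 1 ≤ n → η-X P α (2 * k) n ≡ ℚ.- mulS P (sumRHS α k) n
  even (suc k) _ n _ = η-X-even P α k n
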